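{- Fix $n\ge 3$, $j\in[2,n-1]$ and $\pi\in\mathfrak S_n$. The following are equivalent: (a) $\pi$ possesses a reduced word accepted by the automaton $\mathbb U(j)$; (b) $\pi$ avoids the pattern $jki$ with $i<j<k$. Likewise, the following are equivalent: (a') $\pi$ possesses a reduced word accepted by $\mathbb D(j)$; (b') $\pi$ avoids the pattern $kij$ with $i<j<k$.
   Context: $\mathfrak S_n$ is generated by $s_a=(a\ a{+}1)$, $a\in[n-1]$; a word $s_{a_1}\cdots s_{a_\ell}$ represents $\pi=s_{a_1}\circ\cdots\circ s_{a_\ell}$ (composition of maps), written in one-line notation $\pi(1)\pi(2)\cdots\pi(n)$; it is a reduced word for $\pi$ if $\ell$ is minimal. For fixed $j$, $\pi$ avoids $jki$ (resp. $kij$) if there are no $i<j<k$ such that $j,k,i$ (resp. $k,i,j$) appear in this order in $\pi(1)\cdots\pi(n)$. Automata read words left to right over the alphabet $\{s_1,\dots,s_{n-1}\}$; any letter without a specified transition is a loop; a word is accepted iff the run from the initial state never enters a dead state (dead states are absorbing and rejecting; all other states are accepting). $\mathbb U(j)$: states $H_j$ (initial), $H_{j+1},\dots,H_n$, ill states $I_j,\dots,I_{n-1}$ and a dead state; for $m\in[j,n-1]$: from $H_m$, $s_m\to H_{m+1}$ and $s_{m-1}\to I_m$; from $I_m$, $s_m\to$ dead; $H_n$ loops on every letter. $\mathbb D(j)$: states $G_j$ (initial), $G_{j-1},\dots,G_1$, ill states $J_j,\dots,J_2$ and a dead state; for $m\in[2,j]$: from $G_m$, $s_{m-1}\to G_{m-1}$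 and $s_m\to J_m$; from $J_m$, $s_{m-1}\to$ dead; $G_1$ loops on every letter. -}

module Defs where

open import Data.Nat using (ℕ; zero; suc; _+_; _≤_; _<_; _>_; _≡ᵇ_)
open import Data.Bool using (Bool; true; false; if_then_else_)
open import Data.Fin using (Fin; toℕ)
open import Data.Fin.Permutation using (Permutation′; _⟨$⟩ʳ_)
open import Data.List using (List; []; _∷_; length; foldl)
open import Data.List.Relation.Unary.All using (All)
open import Data.Product using (_×_; Σ; ∃; _,_)
open import Relation.Binary.PropositionalEquality using (_≡_)
open import Relation.Nullary using (¬_)

-- Values/positions are 1-based: position p : Fin n denotes p+1, and
-- the one-line value π(p+1) is 1 + toℕ (π ⟨$⟩ʳ p).
val : ∀ {n} → Permutation′ n → Fin n → ℕ
val π p = suc (toℕ (π ⟨$⟩ʳ p))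

-- A word over {s_1,…,s_{n-1}}: a list of indices a with 1 ≤ a ≤ n-1.
Word : Set
Word = List ℕ

ValidWord : ℕ → Word → Set
ValidWord n w = All (λ a → 1 ≤ a × a < n) w

swap : ℕ → ℕ → ℕ
swap a x = if x ≡ᵇ a then suc a else (if x ≡ᵇ suc a then a else x)

evalWord : Word → ℕ → ℕ
evalWord [] x = x
evalWord (a ∷ w) x = swap a (evalWord w x)

Represents : ∀ {n} → Word → Permutation′ n → Set
Represents {n} w π = ValidWord n w × (∀ (p : Fin n) → evalWord w (suc (toℕ p)) ≡ val π p)

Reduced : ∀ {n} → Word → Permutation′ n → Set
Reduced {n} w π = Represents w π × (∀ (w′ : Word) → Represents w′ π → length w ≤ length w′)

-- Automata. A word is accepted iff the run never enters the dead state;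
-- since the dead state is absorbing, this is iff the final state is not dead.

data UState : Set where
  H    : ℕ → UState
  I    : ℕ → UState
  deadU : UState

-- transition of 𝕌(j) (in ℕ n); unspecified letters loop
stepU : ℕ → UState → ℕ → UState
stepU n (H m) a =
  if m Data.Nat.<ᵇ n
  then (if a ≡ᵇ m then H (suc m) else (if suc a ≡ᵇ m then I m else H m))
  else H m
stepU n (I m) a = if a ≡ᵇ m then deadU else I m
stepU n deadU a = deadU

runU : ℕ → ℕ → Word → UState
runU n j w = foldl (stepU n) (H j) w

AcceptsU : ℕ → ℕ → Word → Set
AcceptsU n j w = ¬ (runU n j w ≡ deadU)

data DState : Set where
  G    : ℕ → DState
  J    : ℕ → DState
  deadD : DState

-- transition of 𝔻(j); G_1 loops on every letter
stepD : DState → ℕ → DState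
stepD (G zero) a = G zero
stepD (G (suc zero)) a = G (suc zero)
stepD (G (suc (suc m))) a =
  if suc a ≡ᵇ suc (suc m) then G (suc m)
  else (if a ≡ᵇ suc (suc m) then J (suc (suc m)) else G (suc (suc m)))
stepD (J m) a = if suc a ≡ᵇ m then deadD else J m
stepD deadD a = deadD

runD : ℕ → Word → DState
runD j w = foldl stepD (G j) w

AcceptsD : ℕ → Word → Set
AcceptsD j w = ¬ (runD j w ≡ deadD)

AvoidsJKI : ∀ {n} → Permutation′ n → ℕ → Set
AvoidsJKI {n} π j = ¬ (Σ (Fin n) λ p → Σ (Fin n) λ q → Σ (Fin n) λ r →
  toℕ p < toℕ q × toℕ q < toℕ r × val π p ≡ j × j < val π q × val π r < j)

AvoidsKIJ : ∀ {n} → Permutation′ n → ℕ → Set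
AvoidsKIJ {n} π j = ¬ (Σ (Fin n) λ p → Σ (Fin n) λ q → Σ (Fin n) λ r →
  toℕ p < toℕ q × toℕ q < toℕ r × j < val π p × val π q < j × val π r ≡ j)

-- Right multiplication by s_a changes the number of inversions by exactly one, so a word is
-- reduced iff its length is the number of inversions of the permutation it represents, and
-- along a reduced word every letter creates an ascent. Each live state of 𝕌(j) (resp. 𝔻(j))
-- records where j sits among the larger and smaller values of the permutation read so far, and
-- the dead state is entered exactly when a jki (resp. kij) occurrence is created. Conversely,
-- for a permutation avoiding the pattern one reads off the state it determines and peels descents
-- off the right compatibly with the transitions, producing an accepted word of minimal length.
module Submission where

open import Defs
open import Data.Nat using (ℕ; zero; suc; _+_; _*_; _∸_; _≤_; _<_; _≡ᵇ_; _<ᵇ_; z≤n; s≤s; _≟_; _<?_; _≤?_)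
open import Data.Nat.Properties
open import Data.Nat.Tactic.RingSolver using (solve-∀)
open import Algebra.Properties.CommutativeSemigroup +-commutativeSemigroup using (xy∙z≈xz∙y)
open import Data.Bool using (true; false; T)
open import Data.Bool.Properties using (T-≡)
open import Data.Fin using (Fin; toℕ; fromℕ<)
open import Data.Fin.Properties using (toℕ<n; fromℕ<-toℕ; toℕ-fromℕ<)
open import Data.Fin.Permutation using (Permutation′; _⟨$⟩ʳ_; _⟨$⟩ˡ_)
  renaming (inverseʳ to ⟨$⟩ʳ∘⟨$⟩ˡ; inverseˡ to ⟨$⟩ˡ∘⟨$⟩ʳ)
open import Data.List using ([]; _∷_; length; foldl; reverse; _∷ʳ_)
open import Data.List.Properties using (foldl-∷ʳ; unfold-reverse; reverse-involutive; length-reverse)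
open import Data.List.Relation.Unary.All using (All; []; _∷_)
open import Data.List.Relation.Unary.All.Properties using (∷ʳ⁺)
open import Data.Product using (_×_; ∃; Σ; _,_; proj₁; proj₂)
open import Data.Sum using (_⊎_; inj₁; inj₂)
open import Data.Empty using (⊥)
open import Data.Unit using (⊤; tt)
open import Function.Bundles using (_⇔_; mk⇔; Equivalence)
open import Relation.Nullary using (¬_; Dec; yes; no; contradiction)
open import Relation.Nullary.Decidable using (_×-dec_)
open import Relation.Unary using (Decidable)
open import Relation.Binary using (tri<; tri≈; tri>)
open import Relation.Binary.PropositionalEquality hiding (J)

≡ᵇ-refl : ∀ m → (m ≡ᵇ m) ≡ true
≡ᵇ-refl zero = refl
≡ᵇ-refl (suc m) = ≡ᵇ-refl m

≢⇒≡ᵇ-false : ∀ {m n} → m ≢ n → (m ≡ᵇ n) ≡ false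
≢⇒≡ᵇ-false {m} {n} m≢n with m ≡ᵇ n in eq
... | true = contradiction (≡ᵇ⇒≡ m n (subst T (sym eq) tt)) m≢n
... | false = refl

<⇒<ᵇ-true : ∀ {m n} → m < n → (m <ᵇ n) ≡ true
<⇒<ᵇ-true m<n = Equivalence.to T-≡ (<⇒<ᵇ m<n)

≮⇒<ᵇ-false : ∀ {m n} → ¬ m < n → (m <ᵇ n) ≡ false
≮⇒<ᵇ-false {m} {n} m≮n with m <ᵇ n in eq
... | true = contradiction (<ᵇ⇒< m n (subst T (sym eq) tt)) m≮n
... | false = refl

swap-self : ∀ a → swap a a ≡ suc a
swap-self a rewrite ≡ᵇ-refl a = refl

swap-suc : ∀ a → swap a (suc a) ≡ a
swap-suc a rewrite ≢⇒≡ᵇ-false (1+n≢n {a}) | ≡ᵇ-refl a = refl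

swap-other : ∀ a {x} → x ≢ a → x ≢ suc a → swap a x ≡ x
swap-other a x≢a x≢1+a rewrite ≢⇒≡ᵇ-false x≢a | ≢⇒≡ᵇ-false x≢1+a = refl

data SwapView (a x : ℕ) : Set where
  left  : x ≡ a → SwapView a x
  right : x ≡ suc a → SwapView a x
  other : x ≢ a → x ≢ suc a → SwapView a x

swapView : ∀ a x → SwapView a x
swapView a x with x ≟ a | x ≟ suc a
... | yes x≡a | _ = left x≡a
... | no _ | yes x≡1+a = right x≡1+a
... | no x≢a | no x≢1+a = other x≢a x≢1+a

swap-involutive : ∀ a x → swap a (swap a x) ≡ x
swap-involutive a x with swapView a x
... | left refl rewrite swap-self a = swap-suc a
... | right refl rewrite swap-suc a = swap-self a
... | other x≢a x≢1+a rewrite swap-other a x≢a x≢1+a = swap-other a x≢a x≢1+a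

swap-<-⊎ : ∀ a {x y} → x < y → swap a x < swap a y ⊎ (x ≡ a × y ≡ suc a)
swap-<-⊎ a {x} {y} x<y with swapView a x | swapView a y
... | left refl  | left refl  = contradiction x<y (<-irrefl refl)
... | left refl  | right refl = inj₂ (refl , refl)
... | left refl  | other y≢a y≢1+a rewrite swap-self a | swap-other a y≢a y≢1+a = inj₁ (≤∧≢⇒< x<y (≢-sym y≢1+a))
... | right refl | left refl  = contradiction x<y (<-asym (n<1+n a))
... | right refl | right refl = contradiction x<y (<-irrefl refl)
... | right refl | other y≢a y≢1+a rewrite swap-suc a | swap-other a y≢a y≢1+a = inj₁ (<-trans (n<1+n a) x<y)
... | other x≢a x≢1+a | left refl  rewrite swap-self a | swap-other a x≢a x≢1+a = inj₁ (<-trans x<y (n<1+n a))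
... | other x≢a x≢1+a | right refl rewrite swap-suc a | swap-other a x≢a x≢1+a = inj₁ (≤∧≢⇒< (≤-pred x<y) x≢a)
... | other x≢a x≢1+a | other y≢a y≢1+a rewrite swap-other a x≢a x≢1+a | swap-other a y≢a y≢1+a = inj₁ x<y

swap-inRange : ∀ {n a x} → 1 ≤ a → a < n → 1 ≤ x → x ≤ n → 1 ≤ swap a x × swap a x ≤ n
swap-inRange {n} {a} {x} 1≤a a<n 1≤x x≤n with swapView a x
... | left refl rewrite swap-self a = s≤s z≤n , a<n
... | right refl rewrite swap-suc a = 1≤a , <⇒≤ a<n
... | other x≢a x≢1+a rewrite swap-other a x≢a x≢1+a = 1≤x , x≤n

swap-above : ∀ a {q r} → q ≢ a → q < r → q < swap a r
swap-above a {q} {r} q≢a q<r with swapView a r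
... | left refl rewrite swap-self a = <-trans q<r (n<1+n a)
... | right refl rewrite swap-suc a = ≤∧≢⇒< (≤-pred q<r) q≢a
... | other r≢a r≢1+a rewrite swap-other a r≢a r≢1+a = q<r

swap-below : ∀ a {q r} → q ≢ suc a → r < q → swap a r < q
swap-below a {q} {r} q≢1+a r<q with swapView a r
... | left refl rewrite swap-self a = ≤∧≢⇒< r<q (≢-sym q≢1+a)
... | right refl rewrite swap-suc a = <-trans (n<1+n a) r<q
... | other r≢a r≢1+a rewrite swap-other a r≢a r≢1+a = r<q

swap-atMost : ∀ a {m r} → m ≢ a → r ≤ m → swap a r ≤ m
swap-atMost a {m} {r} m≢a r≤m with swapView a r
... | left refl rewrite swap-self a = ≤∧≢⇒< r≤m (≢-sym m≢a)
... | right refl rewrite swap-suc a = ≤-trans (n≤1+n a) r≤m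
... | other r≢a r≢1+a rewrite swap-other a r≢a r≢1+a = r≤m

swap-atLeast : ∀ a {m r} → m ≢ suc a → m ≤ r → m ≤ swap a r
swap-atLeast a {m} {r} m≢1+a m≤r with swapView a r
... | left refl rewrite swap-self a = ≤-trans m≤r (n≤1+n a)
... | right refl rewrite swap-suc a = ≤-pred (≤∧≢⇒< m≤r m≢1+a)
... | other r≢a r≢1+a rewrite swap-other a r≢a r≢1+a = m≤r

infixl 9 _∘s_
_∘s_ : (ℕ → ℕ) → ℕ → ℕ → ℕ
(σ ∘s a) x = σ (swap a x)

-- Permutations of {1,…,n} as bijections of ℕ, the setting of evalWord.
record Permutes (n : ℕ) (σ : ℕ → ℕ) : Set where
  field
    σ⁻¹ : ℕ → ℕ
    inverseʳ : ∀ x → σ (σ⁻¹ x) ≡ x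
    inverseˡ : ∀ x → σ⁻¹ (σ x) ≡ x
    σ-inRange : ∀ {x} → 1 ≤ x → x ≤ n → 1 ≤ σ x × σ x ≤ n
    σ⁻¹-inRange : ∀ {x} → 1 ≤ x → x ≤ n → 1 ≤ σ⁻¹ x × σ⁻¹ x ≤ n

  injective : ∀ {x y} → σ x ≡ σ y → x ≡ y
  injective {x} {y} σx≡σy = trans (sym (inverseˡ x)) (trans (cong σ⁻¹ σx≡σy) (inverseˡ y))

open Permutes public

id-permutes : ∀ n → Permutes n (λ x → x)
id-permutes n = record
  { σ⁻¹ = λ x → x ; inverseʳ = λ _ → refl ; inverseˡ = λ _ → refl
  ; σ-inRange = _,_ ; σ⁻¹-inRange = _,_ }

∘swap-permutes : ∀ {n σ a} → 1 ≤ a → a < n → Permutes n σ → Permutes n (σ ∘s a)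
∘swap-permutes {n} {σ} {a} 1≤a a<n P = record
  { σ⁻¹ = λ x → swap a (σ⁻¹ P x)
  ; inverseʳ = λ x → trans (cong σ (swap-involutive a (σ⁻¹ P x))) (inverseʳ P x)
  ; inverseˡ = λ x → trans (cong (swap a) (inverseˡ P (swap a x))) (swap-involutive a x)
  ; σ-inRange = λ 1≤x x≤n → let (1≤y , y≤n) = swap-inRange 1≤a a<n 1≤x x≤n in σ-inRange P 1≤y y≤n
  ; σ⁻¹-inRange = λ 1≤x x≤n → let (1≤y , y≤n) = σ⁻¹-inRange P 1≤x x≤n in swap-inRange 1≤a a<n 1≤y y≤n
  }

sumTo : (ℕ → ℕ) → ℕ → ℕ
sumTo f zero = 0
sumTo f (suc k) = sumTo f k + f (suc k)

sumTo-cong : ∀ {f g} k → (∀ x → 1 ≤ x → x ≤ k → f x ≡ g x) → sumTo f k ≡ sumTo g k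
sumTo-cong zero f≈g = refl
sumTo-cong (suc k) f≈g =
  cong₂ _+_ (sumTo-cong k (λ x 1≤x x≤k → f≈g x 1≤x (m≤n⇒m≤1+n x≤k))) (f≈g (suc k) (s≤s z≤n) ≤-refl)

sumTo-zero : ∀ k → sumTo (λ _ → 0) k ≡ 0
sumTo-zero zero = refl
sumTo-zero (suc k) rewrite sumTo-zero k = refl

sumTo-update : ∀ {f g} k {u} → 1 ≤ u → u ≤ k → (∀ x → 1 ≤ x → x ≤ k → x ≢ u → f x ≡ g x) →
               sumTo f k + g u ≡ sumTo g k + f u
sumTo-update zero () z≤n f≈g
sumTo-update {f} {g} (suc k) {u} 1≤u u≤1+k f≈g with u ≟ suc k
... | yes refl = begin
  sumTo f k + f u + g u ≡⟨ cong (λ t → t + f u + g u) (sumTo-cong k f≈g-below) ⟩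
  sumTo g k + f u + g u ≡⟨ xy∙z≈xz∙y (sumTo g k) (f u) (g u) ⟩
  sumTo g k + g u + f u ∎
  where
  open ≡-Reasoning
  f≈g-below : ∀ x → 1 ≤ x → x ≤ k → f x ≡ g x
  f≈g-below x 1≤x x≤k = f≈g x 1≤x (m≤n⇒m≤1+n x≤k) (<⇒≢ (s≤s x≤k))
... | no u≢1+k = begin
  sumTo f k + f (suc k) + g u ≡⟨ xy∙z≈xz∙y (sumTo f k) (f (suc k)) (g u) ⟩
  sumTo f k + g u + f (suc k) ≡⟨ cong₂ _+_ (sumTo-update k 1≤u (≤-pred (≤∧≢⇒< u≤1+k u≢1+k)) f≈g-below) f≈g-top ⟩
  sumTo g k + f u + g (suc k) ≡⟨ xy∙z≈xz∙y (sumTo g k) (f u) (g (suc k)) ⟩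
  sumTo g k + g (suc k) + f u ∎
  where
  open ≡-Reasoning
  f≈g-below : ∀ x → 1 ≤ x → x ≤ k → x ≢ u → f x ≡ g x
  f≈g-below x 1≤x x≤k = f≈g x 1≤x (m≤n⇒m≤1+n x≤k)
  f≈g-top : f (suc k) ≡ g (suc k)
  f≈g-top = f≈g (suc k) (s≤s z≤n) ≤-refl (≢-sym u≢1+k)

sumTo-update₂ : ∀ {f g} k {u v} → u ≢ v → 1 ≤ u → u ≤ k → 1 ≤ v → v ≤ k →
                (∀ x → 1 ≤ x → x ≤ k → x ≢ u → x ≢ v → f x ≡ g x) →
                sumTo f k + g u + g v ≡ sumTo g k + f u + f v
sumTo-update₂ {f} {g} k {u} {v} u≢v 1≤u u≤k 1≤v v≤k f≈g = begin
  sumTo f k + g u + g v ≡⟨ cong (λ t → sumTo f k + t + g v) (sym h-at-u) ⟩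
  sumTo f k + h u + g v ≡⟨ cong (_+ g v) (sumTo-update k 1≤u u≤k (λ x _ _ x≢u → sym (h-off-u x≢u))) ⟩
  sumTo h k + f u + g v ≡⟨ xy∙z≈xz∙y (sumTo h k) (f u) (g v) ⟩
  sumTo h k + g v + f u ≡⟨ cong (_+ f u) (sumTo-update k 1≤v v≤k h≈g) ⟩
  sumTo g k + h v + f u ≡⟨ cong (λ t → sumTo g k + t + f u) (h-off-u (≢-sym u≢v)) ⟩
  sumTo g k + f v + f u ≡⟨ xy∙z≈xz∙y (sumTo g k) (f v) (f u) ⟩
  sumTo g k + f u + f v ∎
  where
  open ≡-Reasoning
  h : ℕ → ℕ
  h x with x ≟ u
  ... | yes _ = g x
  ... | no _ = f x
  h-at-u : h u ≡ g u
  h-at-u with u ≟ u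
  ... | yes _ = refl
  ... | no u≢u = contradiction refl u≢u
  h-off-u : ∀ {x} → x ≢ u → h x ≡ f x
  h-off-u {x} x≢u with x ≟ u
  ... | yes x≡u = contradiction x≡u x≢u
  ... | no _ = refl
  h≈g : ∀ x → 1 ≤ x → x ≤ k → x ≢ v → h x ≡ g x
  h≈g x 1≤x x≤k x≢v with x ≟ u
  ... | yes _ = refl
  ... | no x≢u = f≈g x 1≤x x≤k x≢u x≢v

sumTo-∘swap : ∀ g {a} k → 1 ≤ a → a < k → sumTo (g ∘s a) k ≡ sumTo g k
sumTo-∘swap g {a} (suc k) 1≤a a<1+k with a ≟ k
sumTo-∘swap g {suc a} (suc (suc a)) 1≤a a<1+k | yes refl = begin
  sumTo g∘s a + g (swap (suc a) (suc a)) + g (swap (suc a) (suc (suc a)))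
    ≡⟨ cong₂ (λ u v → sumTo g∘s a + g u + g v) (swap-self (suc a)) (swap-suc (suc a)) ⟩
  sumTo g∘s a + g (suc (suc a)) + g (suc a)
    ≡⟨ cong (λ t → t + g (suc (suc a)) + g (suc a)) (sumTo-cong a g∘s≈g) ⟩
  sumTo g a + g (suc (suc a)) + g (suc a)
    ≡⟨ xy∙z≈xz∙y (sumTo g a) _ _ ⟩
  sumTo g a + g (suc a) + g (suc (suc a)) ∎
  where
  open ≡-Reasoning
  g∘s : ℕ → ℕ
  g∘s x = g (swap (suc a) x)
  g∘s≈g : ∀ x → 1 ≤ x → x ≤ a → g∘s x ≡ g x
  g∘s≈g x _ x≤a = cong g (swap-other (suc a) (<⇒≢ (s≤s x≤a)) (<⇒≢ (s≤s (m≤n⇒m≤1+n x≤a))))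
... | no a≢k = cong₂ _+_ (sumTo-∘swap g k 1≤a a<k) (cong g (swap-other a (>⇒≢ (<-trans (n<1+n a) 1+a<1+k)) (>⇒≢ 1+a<1+k)))
  where
  a<k : a < k
  a<k = ≤∧≢⇒< (≤-pred a<1+k) a≢k
  1+a<1+k : suc a < suc k
  1+a<1+k = s≤s a<k

indicator : ∀ {A : Set} → Dec A → ℕ
indicator (yes _) = 1
indicator (no _) = 0

indicator-yes : ∀ {A : Set} → A → (d : Dec A) → indicator d ≡ 1
indicator-yes a (yes _) = refl
indicator-yes a (no ¬a) = contradiction a ¬a

indicator-no : ∀ {A : Set} → ¬ A → (d : Dec A) → indicator d ≡ 0
indicator-no ¬a (yes a) = contradiction a ¬a
indicator-no ¬a (no _) = refl

indicator-cong : ∀ {A B : Set} → (A → B) → (B → A) → (d : Dec A) (e : Dec B) → indicator d ≡ indicator e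
indicator-cong f g (yes a) e = sym (indicator-yes (f a) e)
indicator-cong f g (no ¬a) e = sym (indicator-no (λ b → ¬a (g b)) e)

isInversion : (ℕ → ℕ) → ℕ → ℕ → ℕ
isInversion σ x y = indicator (x <? y) * indicator (σ y <? σ x)

inversions : ℕ → (ℕ → ℕ) → ℕ
inversions n σ = sumTo (λ x → sumTo (isInversion σ x) n) n

swap-<?-cong : ∀ a x y → ¬ (x ≡ a × y ≡ suc a) → ¬ (swap a x ≡ a × swap a y ≡ suc a) →
               indicator (swap a x <? swap a y) ≡ indicator (x <? y)
swap-<?-cong a x y not-pair not-swapped-pair = indicator-cong reflect preserve (swap a x <? swap a y) (x <? y)
  where
  preserve : x < y → swap a x < swap a y
  preserve x<y with swap-<-⊎ a x<y
  ... | inj₁ sx<sy = sx<sy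
  ... | inj₂ pair = contradiction pair not-pair
  reflect : swap a x < swap a y → x < y
  reflect sx<sy with swap-<-⊎ a sx<sy
  ... | inj₁ ssx<ssy = subst₂ _<_ (swap-involutive a x) (swap-involutive a y) ssx<ssy
  ... | inj₂ pair = contradiction pair not-swapped-pair

-- Reindexing the double sum by s_a, only the rows and columns a and a+1 change, and there
-- only the single entry recording whether (a, a+1) is an inversion.
module _ (n : ℕ) (σ : ℕ → ℕ) {a : ℕ} (1≤a : 1 ≤ a) (a<n : a < n) where
  private
    s : ℕ → ℕ
    s = swap a

    swappedEntry : ℕ → ℕ → ℕ
    swappedEntry x y = indicator (s x <? s y) * indicator (σ y <? σ x)

    swappedRow row : ℕ → ℕ
    swappedRow x = sumTo (swappedEntry x) n
    row x = sumTo (isInversion σ x) n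

    inversions-reindexed : inversions n (σ ∘s a) ≡ sumTo swappedRow n
    inversions-reindexed = begin
      inversions n (σ ∘s a)
        ≡⟨ sumTo-cong n (λ x _ _ → sumTo-cong n (λ y _ _ → cong (_* indicator (σ (s y) <? σ (s x)))
             (indicator-cong (subst₂ _<_ (sym (swap-involutive a x)) (sym (swap-involutive a y)))
                             (subst₂ _<_ (swap-involutive a x) (swap-involutive a y)) (x <? y) (s (s x) <? s (s y))))) ⟩
      sumTo (λ x → sumTo (λ y → swappedEntry (s x) (s y)) n) n
        ≡⟨ sumTo-cong n (λ x _ _ → sumTo-∘swap (swappedEntry (s x)) n 1≤a a<n) ⟩
      sumTo (λ x → swappedRow (s x)) n
        ≡⟨ sumTo-∘swap swappedRow n 1≤a a<n ⟩
      sumTo swappedRow n ∎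
      where open ≡-Reasoning

    swappedRow-other : ∀ x → x ≢ a → x ≢ suc a → swappedRow x ≡ row x
    swappedRow-other x x≢a x≢1+a = sumTo-cong n (λ y _ _ → cong (_* indicator (σ y <? σ x))
      (swap-<?-cong a x y (λ pair → x≢a (proj₁ pair)) (λ pair → x≢a (trans (sym (swap-other a x≢a x≢1+a)) (proj₁ pair)))))

    swappedRow-a : swappedRow a + indicator (σ (suc a) <? σ a) ≡ row a
    swappedRow-a = begin
      swappedRow a + indicator (σ (suc a) <? σ a)
        ≡⟨ cong (swappedRow a +_) (sym (*-identityˡ _)) ⟩
      swappedRow a + 1 * indicator (σ (suc a) <? σ a)
        ≡⟨ cong (λ t → swappedRow a + t * indicator (σ (suc a) <? σ a)) (sym (indicator-yes (n<1+n a) (a <? suc a))) ⟩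
      swappedRow a + isInversion σ a (suc a)
        ≡⟨ sumTo-update n (s≤s z≤n) a<n (λ y _ _ y≢1+a → cong (_* indicator (σ y <? σ a))
             (swap-<?-cong a a y (λ pair → y≢1+a (proj₂ pair)) (λ pair → 1+n≢n (trans (sym (swap-self a)) (proj₁ pair))))) ⟩
      row a + swappedEntry a (suc a)
        ≡⟨ cong (row a +_) entry-vanishes ⟩
      row a + 0
        ≡⟨ +-identityʳ _ ⟩
      row a ∎
      where
      open ≡-Reasoning
      entry-vanishes : swappedEntry a (suc a) ≡ 0
      entry-vanishes rewrite swap-self a | swap-suc a | indicator-no (<-asym (n<1+n a)) (suc a <? a) = refl

    swappedRow-suc : swappedRow (suc a) ≡ row (suc a) + indicator (σ a <? σ (suc a))
    swappedRow-suc = begin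
      swappedRow (suc a)
        ≡⟨ sym (+-identityʳ _) ⟩
      swappedRow (suc a) + 0
        ≡⟨ cong (swappedRow (suc a) +_) (sym entry-vanishes) ⟩
      swappedRow (suc a) + isInversion σ (suc a) a
        ≡⟨ sumTo-update n 1≤a (<⇒≤ a<n) (λ y _ _ y≢a → cong (_* indicator (σ y <? σ (suc a)))
             (swap-<?-cong a (suc a) y (λ pair → 1+n≢n (proj₁ pair))
               (λ pair → y≢a (trans (sym (swap-involutive a y)) (trans (cong s (proj₂ pair)) (swap-suc a)))))) ⟩
      row (suc a) + swappedEntry (suc a) a
        ≡⟨ cong (row (suc a) +_) swapped-entry ⟩
      row (suc a) + indicator (σ a <? σ (suc a)) ∎
      where
      open ≡-Reasoning
      entry-vanishes : isInversion σ (suc a) a ≡ 0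
      entry-vanishes rewrite indicator-no (<-asym (n<1+n a)) (suc a <? a) = refl
      swapped-entry : swappedEntry (suc a) a ≡ indicator (σ a <? σ (suc a))
      swapped-entry rewrite swap-self a | swap-suc a | indicator-yes (n<1+n a) (a <? suc a) = +-identityʳ _

  inversions-∘swap : inversions n (σ ∘s a) + indicator (σ (suc a) <? σ a)
                   ≡ inversions n σ + indicator (σ a <? σ (suc a))
  inversions-∘swap = +-cancelʳ-≡ (swappedRow a + row (suc a)) _ _ (begin
    inversions n (σ ∘s a) + down + (swappedRow a + row (suc a))
      ≡⟨ cong (λ t → t + down + (swappedRow a + row (suc a))) inversions-reindexed ⟩
    sumTo swappedRow n + down + (swappedRow a + row (suc a))
      ≡⟨ regroupˡ (sumTo swappedRow n) down (swappedRow a) (row (suc a)) ⟩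
    sumTo swappedRow n + (swappedRow a + down) + row (suc a)
      ≡⟨ cong (λ t → sumTo swappedRow n + t + row (suc a)) swappedRow-a ⟩
    sumTo swappedRow n + row a + row (suc a)
      ≡⟨ sumTo-update₂ n (<⇒≢ (n<1+n a)) 1≤a (<⇒≤ a<n) (s≤s z≤n) a<n (λ x _ _ → swappedRow-other x) ⟩
    sumTo row n + swappedRow a + swappedRow (suc a)
      ≡⟨ cong (sumTo row n + swappedRow a +_) swappedRow-suc ⟩
    sumTo row n + swappedRow a + (row (suc a) + up)
      ≡⟨ regroupʳ (sumTo row n) (swappedRow a) (row (suc a)) up ⟩
    sumTo row n + up + (swappedRow a + row (suc a)) ∎)
    where
    open ≡-Reasoning
    down up : ℕ
    down = indicator (σ (suc a) <? σ a)
    up = indicator (σ a <? σ (suc a))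
    regroupˡ : ∀ (A e b c : ℕ) → A + e + (b + c) ≡ A + (b + e) + c
    regroupˡ = solve-∀
    regroupʳ : ∀ (A b c f : ℕ) → A + b + (c + f) ≡ A + f + (b + c)
    regroupʳ = solve-∀

AgreeOn : ℕ → (ℕ → ℕ) → (ℕ → ℕ) → Set
AgreeOn n f g = ∀ x → 1 ≤ x → x ≤ n → f x ≡ g x

inversions-cong : ∀ n {σ σ′} → AgreeOn n σ σ′ → inversions n σ ≡ inversions n σ′
inversions-cong n σ≈σ′ = sumTo-cong n (λ x 1≤x x≤n → sumTo-cong n (λ y 1≤y y≤n →
  cong (indicator (x <? y) *_) (cong₂ (λ u v → indicator (u <? v)) (σ≈σ′ y 1≤y y≤n) (σ≈σ′ x 1≤x x≤n))))

module _ {Q : ℕ → Set} (Q? : Decidable Q) where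

  greatest≤ : ∀ N → (∃ λ x → x ≤ N × Q x × (∀ y → x < y → y ≤ N → ¬ Q y)) ⊎ (∀ y → y ≤ N → ¬ Q y)
  greatest≤ zero with Q? zero
  ... | yes q = inj₁ (zero , z≤n , q , λ y x<y y≤0 → contradiction (<-≤-trans x<y y≤0) (<-irrefl refl))
  ... | no ¬q = inj₂ λ { .zero z≤n → ¬q }
  greatest≤ (suc N) with Q? (suc N) | greatest≤ N
  ... | yes q | _ = inj₁ (suc N , ≤-refl , q , λ y x<y y≤1+N → contradiction (<-≤-trans x<y y≤1+N) (<-irrefl refl))
  ... | no ¬q | inj₁ (x , x≤N , qx , above) = inj₁ (x , m≤n⇒m≤1+n x≤N , qx , above′)
    where
    above′ : ∀ y → x < y → y ≤ suc N → ¬ Q y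
    above′ y x<y y≤1+N with y ≟ suc N
    ... | yes refl = ¬q
    ... | no y≢1+N = above y x<y (≤-pred (≤∧≢⇒< y≤1+N y≢1+N))
  ... | no ¬q | inj₂ none = inj₂ none′
    where
    none′ : ∀ y → y ≤ suc N → ¬ Q y
    none′ y y≤1+N with y ≟ suc N
    ... | yes refl = ¬q
    ... | no y≢1+N = none y (≤-pred (≤∧≢⇒< y≤1+N y≢1+N))

  least≤ : ∀ N → (∃ λ x → x ≤ N × Q x × (∀ y → y < x → ¬ Q y)) ⊎ (∀ y → y ≤ N → ¬ Q y)
  least≤ zero with Q? zero
  ... | yes q = inj₁ (zero , z≤n , q , λ y ())
  ... | no ¬q = inj₂ λ { .zero z≤n → ¬q }
  least≤ (suc N) with least≤ N | Q? (suc N)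
  ... | inj₁ (x , x≤N , qx , below) | _ = inj₁ (x , m≤n⇒m≤1+n x≤N , qx , below)
  ... | inj₂ none | yes q = inj₁ (suc N , ≤-refl , q , λ y y<1+N → none y (≤-pred y<1+N))
  ... | inj₂ none | no ¬q = inj₂ none′
    where
    none′ : ∀ y → y ≤ suc N → ¬ Q y
    none′ y y≤1+N with y ≟ suc N
    ... | yes refl = ¬q
    ... | no y≢1+N = none y (≤-pred (≤∧≢⇒< y≤1+N y≢1+N))

NoDescent : ℕ → (ℕ → ℕ) → Set
NoDescent n σ = ∀ d → 1 ≤ d → d < n → ¬ σ (suc d) < σ d

descent? : ∀ n σ → (∃ λ d → 1 ≤ d × d < n × σ (suc d) < σ d) ⊎ NoDescent n σ
descent? n σ with least≤ (λ d → (1 ≤? d) ×-dec ((suc d ≤? n) ×-dec (σ (suc d) <? σ d))) n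
... | inj₁ (d , _ , (1≤d , d<n , descent) , _) = inj₁ (d , 1≤d , d<n , descent)
... | inj₂ none = inj₂ λ d 1≤d d<n descent → none d (<⇒≤ d<n) (1≤d , d<n , descent)

module _ {n σ} (P : Permutes n σ) (ascending : NoDescent n σ) where
  private
    ascent : ∀ d → 1 ≤ d → d < n → σ d < σ (suc d)
    ascent d 1≤d d<n = ≤∧≢⇒< (≮⇒≥ (ascending d 1≤d d<n)) (λ σd≡σ1+d → 1+n≢n (sym (injective P σd≡σ1+d)))

    increasing : ∀ x y → 1 ≤ x → x < y → y ≤ n → σ x < σ y
    increasing x (suc y) 1≤x x<1+y 1+y≤n with x ≟ y
    ... | yes refl = ascent x 1≤x 1+y≤n
    ... | no x≢y = <-trans (increasing x y 1≤x (≤∧≢⇒< (≤-pred x<1+y) x≢y) (<⇒≤ 1+y≤n))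
                           (ascent y (≤-trans 1≤x (≤-pred x<1+y)) 1+y≤n)

    ≥-self : ∀ x → 1 ≤ x → x ≤ n → x ≤ σ x
    ≥-self (suc zero) _ 1≤n = proj₁ (σ-inRange P ≤-refl 1≤n)
    ≥-self (suc (suc x)) _ 2+x≤n =
      <-≤-trans (s≤s (≥-self (suc x) (s≤s z≤n) (<⇒≤ 2+x≤n))) (ascent (suc x) (s≤s z≤n) 2+x≤n)

    ≤-self : ∀ d x → 1 ≤ x → x + d ≡ n → σ x ≤ x
    ≤-self zero x 1≤x x+0≡n with trans (sym (+-identityʳ x)) x+0≡n
    ... | refl = proj₂ (σ-inRange P 1≤x ≤-refl)
    ≤-self (suc d) x 1≤x x+1+d≡n =
      ≤-pred (<-≤-trans (ascent x 1≤x x<n) (≤-self d (suc x) (s≤s z≤n) (trans (sym (+-suc x d)) x+1+d≡n)))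
      where
      x<n : x < n
      x<n = subst (x <_) x+1+d≡n (m<m+n x (s≤s z≤n))

  no-descent⇒identity : AgreeOn n σ (λ x → x)
  no-descent⇒identity x 1≤x x≤n = ≤-antisym (≤-self (n ∸ x) x 1≤x (m+[n∸m]≡n x≤n)) (≥-self x 1≤x x≤n)

  no-descent⇒inversions≡0 : inversions n σ ≡ 0
  no-descent⇒inversions≡0 =
    trans (sumTo-cong n (λ x 1≤x x≤n → trans (sumTo-cong n (λ y _ y≤n → no-inversion x y 1≤x y≤n)) (sumTo-zero n)))
          (sumTo-zero n)
    where
    no-inversion : ∀ x y → 1 ≤ x → y ≤ n → isInversion σ x y ≡ 0
    no-inversion x y 1≤x y≤n with x <? y
    ... | yes x<y = cong (1 *_) (indicator-no (<-asym (increasing x y 1≤x x<y y≤n)) (σ y <? σ x))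
    ... | no _ = refl

-- Words are handled reversed, so that consing a letter onto r appends it to reverse r on the right.
evalReversed : Word → ℕ → ℕ
evalReversed [] x = x
evalReversed (a ∷ r) x = evalReversed r (swap a x)

evalReversed-∷ʳ : ∀ r a x → evalReversed (r ∷ʳ a) x ≡ swap a (evalReversed r x)
evalReversed-∷ʳ [] a x = refl
evalReversed-∷ʳ (b ∷ r) a x = evalReversed-∷ʳ r a (swap b x)

evalReversed-reverse : ∀ w x → evalReversed (reverse w) x ≡ evalWord w x
evalReversed-reverse [] x = refl
evalReversed-reverse (a ∷ w) x rewrite unfold-reverse a w =
  trans (evalReversed-∷ʳ (reverse w) a x) (cong (swap a) (evalReversed-reverse w x))

All-reverse : ∀ {P : ℕ → Set} xs → All P xs → All P (reverse xs)
All-reverse [] [] = []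
All-reverse (x ∷ xs) (px ∷ pxs) rewrite unfold-reverse x xs = ∷ʳ⁺ (All-reverse xs pxs) px

evalReversed-permutes : ∀ {n} r → ValidWord n r → Permutes n (evalReversed r)
evalReversed-permutes {n} [] [] = id-permutes n
evalReversed-permutes (a ∷ r) ((1≤a , a<n) ∷ valid) = ∘swap-permutes 1≤a a<n (evalReversed-permutes r valid)

evalReversed-∘swap : ∀ {n σ} r {a} → 1 ≤ a → a < n → AgreeOn n (evalReversed r) (σ ∘s a) →
                     AgreeOn n (evalReversed (a ∷ r)) σ
evalReversed-∘swap {σ = σ} r {a} 1≤a a<n r≈σs x 1≤x x≤n =
  let (1≤sx , sx≤n) = swap-inRange 1≤a a<n 1≤x x≤n in
  trans (r≈σs (swap a x) 1≤sx sx≤n) (cong σ (swap-involutive a x))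

data InversionsStep (n : ℕ) (σ : ℕ → ℕ) (a : ℕ) : Set where
  ascent  : σ a < σ (suc a) → inversions n (σ ∘s a) ≡ suc (inversions n σ) → InversionsStep n σ a
  descent : σ (suc a) < σ a → suc (inversions n (σ ∘s a)) ≡ inversions n σ → InversionsStep n σ a

inversionsStep : ∀ {n σ a} → Permutes n σ → 1 ≤ a → a < n → InversionsStep n σ a
inversionsStep {n} {σ} {a} P 1≤a a<n with <-cmp (σ a) (σ (suc a))
... | tri< up _ _ = ascent up (begin
  inversions n (σ ∘s a)                   ≡⟨ sym (+-identityʳ _) ⟩
  inversions n (σ ∘s a) + 0               ≡⟨ cong (inversions n (σ ∘s a) +_) (sym (indicator-no (<-asym up) (σ (suc a) <? σ a))) ⟩
  inversions n (σ ∘s a) + indicator (σ (suc a) <? σ a) ≡⟨ inversions-∘swap n σ 1≤a a<n ⟩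
  inversions n σ + indicator (σ a <? σ (suc a))   ≡⟨ cong (inversions n σ +_) (indicator-yes up (σ a <? σ (suc a))) ⟩
  inversions n σ + 1                ≡⟨ +-comm _ 1 ⟩
  suc (inversions n σ)              ∎)
  where
  open ≡-Reasoning
... | tri≈ _ σa≡σ1+a _ = contradiction (sym (injective P σa≡σ1+a)) 1+n≢n
... | tri> _ _ down = descent down (begin
  suc (inversions n (σ ∘s a))             ≡⟨ +-comm 1 _ ⟩
  inversions n (σ ∘s a) + 1               ≡⟨ cong (inversions n (σ ∘s a) +_) (sym (indicator-yes down (σ (suc a) <? σ a))) ⟩
  inversions n (σ ∘s a) + indicator (σ (suc a) <? σ a) ≡⟨ inversions-∘swap n σ 1≤a a<n ⟩
  inversions n σ + indicator (σ a <? σ (suc a))   ≡⟨ cong (inversions n σ +_) (indicator-no (<-asym down) (σ a <? σ (suc a))) ⟩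
  inversions n σ + 0                ≡⟨ +-identityʳ _ ⟩
  inversions n σ                    ∎)
  where
  open ≡-Reasoning

inversions-evalReversed≤length : ∀ {n} r → ValidWord n r → inversions n (evalReversed r) ≤ length r
inversions-evalReversed≤length {n} [] [] =
  ≤-reflexive (no-descent⇒inversions≡0 (id-permutes n) (λ d _ _ d+1<d → <-asym d+1<d (n<1+n d)))
inversions-evalReversed≤length (a ∷ r) ((1≤a , a<n) ∷ valid)
  with inversionsStep (evalReversed-permutes r valid) 1≤a a<n
... | ascent _ eq = ≤-trans (≤-reflexive eq) (s≤s (inversions-evalReversed≤length r valid))
... | descent _ eq = m≤n⇒m≤1+n (≤-trans (n≤1+n _) (≤-trans (≤-reflexive eq) (inversions-evalReversed≤length r valid)))

RepresentsOn : ℕ → Word → (ℕ → ℕ) → Set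
RepresentsOn n w σ = ValidWord n w × AgreeOn n (evalWord w) σ

ReducedOn : ℕ → Word → (ℕ → ℕ) → Set
ReducedOn n w σ = RepresentsOn n w σ × (∀ w′ → RepresentsOn n w′ σ → length w ≤ length w′)

reverse-represents : ∀ {n σ} r → ValidWord n r → AgreeOn n (evalReversed r) σ → RepresentsOn n (reverse r) σ
reverse-represents r valid r≈σ = All-reverse r valid , λ x 1≤x x≤n →
  trans (sym (evalReversed-reverse (reverse r) x)) (trans (cong (λ t → evalReversed t x) (reverse-involutive r)) (r≈σ x 1≤x x≤n))

inversions≤length : ∀ {n σ} w → RepresentsOn n w σ → inversions n σ ≤ length w
inversions≤length {n} {σ} w (valid , w≈σ) = begin
  inversions n σ                          ≡⟨ inversions-cong n (λ x 1≤x x≤n → trans (sym (w≈σ x 1≤x x≤n)) (sym (evalReversed-reverse w x))) ⟩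
  inversions n (evalReversed (reverse w)) ≤⟨ inversions-evalReversed≤length (reverse w) (All-reverse w valid) ⟩
  length (reverse w)                      ≡⟨ length-reverse w ⟩
  length w                                ∎
  where open ≤-Reasoning

length≡inversions⇒reduced : ∀ {n σ} w → RepresentsOn n w σ → length w ≡ inversions n σ → ReducedOn n w σ
length≡inversions⇒reduced w rep len = rep , λ w′ rep′ → ≤-trans (≤-reflexive len) (inversions≤length w′ rep′)

module ReversedRuns (n : ℕ) {St : Set} (step : St → ℕ → St) (start : St) where

  runReversed : Word → St
  runReversed [] = start
  runReversed (a ∷ r) = step (runReversed r) a

  foldl-reverse : ∀ r → foldl step start (reverse r) ≡ runReversed r
  foldl-reverse [] = refl
  foldl-reverse (a ∷ r) rewrite unfold-reverse a r =
    trans (foldl-∷ʳ step start a (reverse r)) (cong (λ S → step S a) (foldl-reverse r))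

  -- Undoing a descent lowers the number of inversions, so peeling descents off the right
  -- builds a word of length inversions n σ, tracing a run that ends in the given state.
  module Peeling
    (Good : St → (ℕ → ℕ) → Set)
    (good-descent : ∀ {σ S d} → Permutes n σ → Good S σ → 1 ≤ d → d < n → σ (suc d) < σ d →
      Σ ℕ λ a → Σ St λ S′ → 1 ≤ a × a < n × σ (suc a) < σ a × Good S′ (σ ∘s a) × step S′ a ≡ S)
    (good-identity : ∀ {σ S} → AgreeOn n σ (λ x → x) → Good S σ → S ≡ start)
    where

    peel : ∀ k {σ S} → Permutes n σ → inversions n σ ≡ k → Good S σ →
      Σ Word λ r → ValidWord n r × length r ≡ k × AgreeOn n (evalReversed r) σ × runReversed r ≡ S
    peel k {σ} P inv≡k good with descent? n σ
    ... | inj₂ ascending =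
      [] , [] , trans (sym (no-descent⇒inversions≡0 P ascending)) inv≡k ,
      (λ x 1≤x x≤n → sym (no-descent⇒identity P ascending x 1≤x x≤n)) ,
      sym (good-identity (no-descent⇒identity P ascending) good)
    ... | inj₁ (d , 1≤d , d<n , desc) with good-descent P good 1≤d d<n desc
    ... | a , S′ , 1≤a , a<n , desc′ , good′ , step≡ with k | inversionsStep P 1≤a a<n
    ...   | _ | ascent up _ = contradiction desc′ (<-asym up)
    ...   | zero | descent _ eq with () ← trans eq inv≡k
    ...   | suc k′ | descent _ eq =
      let (r , valid , len , r≈σs , run) = peel k′ (∘swap-permutes 1≤a a<n P) (suc-injective (trans eq inv≡k)) good′ in
      a ∷ r , (1≤a , a<n) ∷ valid , cong suc len , evalReversed-∘swap r 1≤a a<n r≈σs ,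
      trans (cong (λ S → step S a) run) step≡

minimal-word : ∀ {n σ} → Permutes n σ → ∃ λ w → RepresentsOn n w σ × length w ≡ inversions n σ
minimal-word {n} {σ} P =
  let (r , valid , len , r≈σ , _) = peel (inversions n σ) P refl tt in
  reverse r , reverse-represents r valid r≈σ , trans (length-reverse r) len
  where
  open ReversedRuns n {⊤} (λ _ _ → tt) tt
  open Peeling (λ _ _ → ⊤) (λ {_} {_} {d} _ _ 1≤d d<n desc → d , tt , 1≤d , d<n , desc , tt , refl) (λ _ _ → refl)

reduced⇒length≡inversions : ∀ {n σ} w → Permutes n σ → ReducedOn n w σ → length w ≡ inversions n σ
reduced⇒length≡inversions w P (rep , minimal) =
  let (w₀ , rep₀ , len₀) = minimal-word P in
  ≤-antisym (≤-trans (minimal w₀ rep₀) (≤-reflexive len₀)) (inversions≤length w rep)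

-- An automaton accepts a reduced word of σ iff σ avoids a pattern, given an invariant Good
-- linking states to permutations that is respected by ascents read forward and by descents
-- peeled backward.
module Criterion
  (n : ℕ) {St : Set} (step : St → ℕ → St) (start dead : St)
  (Avoids : (ℕ → ℕ) → Set)
  (avoids-cong : ∀ {σ σ′} → AgreeOn n σ σ′ → Avoids σ → Avoids σ′)
  (Good : St → (ℕ → ℕ) → Set)
  (dead-absorbing : ∀ a → step dead a ≡ dead)
  (good-start : Good start (λ x → x))
  (good-ascent : ∀ {σ S a} → Permutes n σ → 1 ≤ a → a < n → σ a < σ (suc a) → Good S σ →
    Good (step S a) (σ ∘s a) ⊎ step S a ≡ dead)
  (good⇒avoids : ∀ {σ S} → Permutes n σ → Good S σ → Avoids σ)
  (good⇒alive : ∀ {σ S} → Good S σ → S ≢ dead)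
  (avoids⇒good : ∀ {σ} → Permutes n σ → Avoids σ → ∃ λ S → Good S σ)
  (good-descent : ∀ {σ S d} → Permutes n σ → Good S σ → 1 ≤ d → d < n → σ (suc d) < σ d →
    Σ ℕ λ a → Σ St λ S′ → 1 ≤ a × a < n × σ (suc a) < σ a × Good S′ (σ ∘s a) × step S′ a ≡ S)
  (good-identity : ∀ {σ S} → AgreeOn n σ (λ x → x) → Good S σ → S ≡ start)
  where

  open ReversedRuns n step start
  open Peeling Good good-descent good-identity

  -- On a word of length equal to its number of inversions every letter is an ascent.
  good-or-dead : ∀ r → ValidWord n r → inversions n (evalReversed r) ≡ length r →
                 runReversed r ≡ dead ⊎ Good (runReversed r) (evalReversed r)
  good-or-dead [] [] _ = inj₂ good-start
  good-or-dead (a ∷ r) ((1≤a , a<n) ∷ valid) inv≡len with inversionsStep (evalReversed-permutes r valid) 1≤a a<n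
  ... | descent _ eq = contradiction (inversions-evalReversed≤length r valid) (<⇒≱ too-many)
    where
    too-many : length r < inversions n (evalReversed r)
    too-many = ≤-trans (n≤1+n _) (≤-reflexive (trans (cong suc (sym inv≡len)) eq))
  ... | ascent up eq with good-or-dead r valid (suc-injective (trans (sym eq) inv≡len))
  ...   | inj₁ dead≡ = inj₁ (trans (cong (λ S → step S a) dead≡) (dead-absorbing a))
  ...   | inj₂ good with good-ascent (evalReversed-permutes r valid) 1≤a a<n up good
  ...     | inj₁ good′ = inj₂ good′
  ...     | inj₂ dead≡ = inj₁ dead≡

  accepted-reduced⇒avoids : ∀ {σ} w → Permutes n σ → ReducedOn n w σ → foldl step start w ≢ dead → Avoids σ
  accepted-reduced⇒avoids {σ} w P reduced@((valid , w≈σ) , _) alive =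
    conclude (good-or-dead (reverse w) (All-reverse w valid) inv≡len)
    where
    r≈σ : AgreeOn n (evalReversed (reverse w)) σ
    r≈σ x 1≤x x≤n = trans (evalReversed-reverse w x) (w≈σ x 1≤x x≤n)
    inv≡len : inversions n (evalReversed (reverse w)) ≡ length (reverse w)
    inv≡len = trans (inversions-cong n r≈σ) (trans (sym (reduced⇒length≡inversions w P reduced)) (sym (length-reverse w)))
    run≡ : runReversed (reverse w) ≡ foldl step start w
    run≡ = trans (sym (foldl-reverse (reverse w))) (cong (foldl step start) (reverse-involutive w))
    conclude : runReversed (reverse w) ≡ dead ⊎ Good (runReversed (reverse w)) (evalReversed (reverse w)) → Avoids σ
    conclude (inj₁ dead≡) = contradiction (trans (sym run≡) dead≡) alive
    conclude (inj₂ good) = avoids-cong r≈σ (good⇒avoids (evalReversed-permutes (reverse w) (All-reverse w valid)) good)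

  avoids⇒accepted-reduced : ∀ {σ} → Permutes n σ → Avoids σ → ∃ λ w → ReducedOn n w σ × foldl step start w ≢ dead
  avoids⇒accepted-reduced {σ} P avoids =
    let (S , good) = avoids⇒good P avoids
        (r , valid , len , r≈σ , run) = peel (inversions n σ) P refl good
    in reverse r ,
       length≡inversions⇒reduced (reverse r) (reverse-represents r valid r≈σ) (trans (length-reverse r) len) ,
       λ dead≡ → good⇒alive good (trans (sym run) (trans (sym (foldl-reverse r)) dead≡))

  accepted-reduced⇔avoids : ∀ {σ} → Permutes n σ → (∃ λ w → ReducedOn n w σ × foldl step start w ≢ dead) ⇔ Avoids σ
  accepted-reduced⇔avoids P =
    mk⇔ (λ (w , reduced , alive) → accepted-reduced⇒avoids w P reduced alive) (avoids⇒accepted-reduced P)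

PatternJKI PatternKIJ : ℕ → ℕ → ℕ → ℕ → Set
PatternJKI j u v w = u ≡ j × j < v × w < j
PatternKIJ j u v w = j < u × v < j × w ≡ j

Occurs : ℕ → (ℕ → ℕ → ℕ → Set) → (ℕ → ℕ) → Set
Occurs n R σ = Σ ℕ λ x → Σ ℕ λ y → Σ ℕ λ z → 1 ≤ x × x < y × y < z × z ≤ n × R (σ x) (σ y) (σ z)

occurs-cong : ∀ n R {σ σ′} → AgreeOn n σ σ′ → Occurs n R σ → Occurs n R σ′
occurs-cong n R {σ} {σ′} σ≈σ′ (x , y , z , 1≤x , x<y , y<z , z≤last , Rxyz) =
  x , y , z , 1≤x , x<y , y<z , z≤last ,
  subst₂ (R (σ′ x)) (σ≈σ′ y 1≤y y≤n) (σ≈σ′ z 1≤z z≤last) (subst (λ u → R u (σ y) (σ z)) (σ≈σ′ x 1≤x x≤n) Rxyz)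
  where
  y≤n : y ≤ n
  y≤n = <⇒≤ (<-≤-trans y<z z≤last)
  x≤n : x ≤ n
  x≤n = <⇒≤ (<-≤-trans x<y y≤n)
  1≤y : 1 ≤ y
  1≤y = ≤-trans 1≤x (<⇒≤ x<y)
  1≤z : 1 ≤ z
  1≤z = ≤-trans 1≤y (<⇒≤ y<z)

avoids-cong : ∀ n R {σ σ′} → AgreeOn n σ σ′ → ¬ Occurs n R σ → ¬ Occurs n R σ′
avoids-cong n R σ≈σ′ avoids occurs = avoids (occurs-cong n R (λ x 1≤x x≤n → sym (σ≈σ′ x 1≤x x≤n)) occurs)

module AutomatonU (n j : ℕ) (1≤j : 1 ≤ j) (j<n : j < n) where

  step-Hₘ-sₘ : ∀ {m} → m < n → stepU n (H m) m ≡ H (suc m)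
  step-Hₘ-sₘ {m} m<n rewrite <⇒<ᵇ-true m<n | ≡ᵇ-refl m = refl

  step-Hₘ-sₘ₋₁ : ∀ {a} → suc a < n → stepU n (H (suc a)) a ≡ I (suc a)
  step-Hₘ-sₘ₋₁ {a} 1+a<n rewrite <⇒<ᵇ-true 1+a<n | ≢⇒≡ᵇ-false (≢-sym (1+n≢n {a})) | ≡ᵇ-refl a = refl

  step-Hₘ-other : ∀ {m a} → a ≢ m → suc a ≢ m → stepU n (H m) a ≡ H m
  step-Hₘ-other {m} a≢m 1+a≢m rewrite ≢⇒≡ᵇ-false a≢m | ≢⇒≡ᵇ-false 1+a≢m with m <ᵇ n
  ... | true = refl
  ... | false = refl

  step-Hₙ : ∀ a → stepU n (H n) a ≡ H n
  step-Hₙ a rewrite ≮⇒<ᵇ-false (<-irrefl {n} refl) = refl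

  step-Iₘ-sₘ : ∀ m → stepU n (I m) m ≡ deadU
  step-Iₘ-sₘ m rewrite ≡ᵇ-refl m = refl

  step-Iₘ-other : ∀ {m a} → a ≢ m → stepU n (I m) a ≡ I m
  step-Iₘ-other a≢m rewrite ≢⇒≡ᵇ-false a≢m = refl

  LargerAfter : ℕ → (ℕ → ℕ) → Set
  LargerAfter m σ = ∀ r → m < r → r ≤ n → j < σ r

  NoLargerAfterJ : (ℕ → ℕ) → Set
  NoLargerAfterJ σ = ∀ x y → 1 ≤ x → x < y → y ≤ n → σ x ≡ j → ¬ j < σ y

  Good : UState → (ℕ → ℕ) → Set
  Good (H q) σ = (q < n × 1 ≤ q × σ q ≡ j × LargerAfter q σ) ⊎ (q ≡ n × NoLargerAfterJ σ)
  Good (I m) σ = m < n × Σ ℕ λ p → 1 ≤ p × p < m × σ p ≡ j × (∀ r → p < r → r ≤ m → σ r < j) × LargerAfter m σ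
  Good deadU σ = ⊥

  good-start : Good (H j) (λ x → x)
  good-start = inj₁ (j<n , 1≤j , refl , λ r j<r _ → j<r)

  larger-after-∘s : ∀ {σ a m} → 1 ≤ a → a < n → 1 ≤ m → m ≢ a → LargerAfter m σ → LargerAfter m (σ ∘s a)
  larger-after-∘s {a = a} 1≤a a<n 1≤m m≢a larger r m<r r≤n =
    larger (swap a r) (swap-above a m≢a m<r) (proj₂ (swap-inRange 1≤a a<n (≤-trans 1≤m (<⇒≤ m<r)) r≤n))

  larger-after-unmoved : ∀ {σ a m} → a < m → LargerAfter m σ → LargerAfter m (σ ∘s a)
  larger-after-unmoved {σ} {a} a<m larger r m<r r≤n =
    subst (j <_) (sym (cong σ (swap-other a (>⇒≢ (<-trans a<m m<r)) (>⇒≢ (≤-<-trans a<m m<r))))) (larger r m<r r≤n)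

  ascent-H : ∀ {σ a q} → Permutes n σ → 1 ≤ a → a < n → σ a < σ (suc a) → q < n → 1 ≤ q → σ q ≡ j → LargerAfter q σ →
             Good (stepU n (H q) a) (σ ∘s a)
  ascent-H {σ} {a} {q} P 1≤a a<n up q<n 1≤q σq≡j larger with a ≟ q
  ... | yes refl rewrite step-Hₘ-sₘ a<n with suc a <? n
  ...   | yes 1+a<n = inj₁ (1+a<n , s≤s z≤n , trans (cong σ (swap-suc a)) σq≡j ,
                          larger-after-unmoved (n<1+n a) (λ r a<r r≤n → larger r (<-trans (n<1+n a) a<r) r≤n))
  ...   | no 1+a≮n = inj₂ (1+a≡n , λ x y _ x<y y≤n σsx≡j _ →
                          let x≡1+a = injective (∘swap-permutes 1≤a a<n P) (trans σsx≡j (sym (trans (cong σ (swap-suc a)) σq≡j))) in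
                          <-irrefl refl (≤-trans (subst (_< y) (trans x≡1+a 1+a≡n) x<y) y≤n))
    where
    1+a≡n : suc a ≡ n
    1+a≡n = ≤-antisym a<n (≮⇒≥ 1+a≮n)
  ascent-H {σ} {a} {q} P 1≤a a<n up q<n 1≤q σq≡j larger | no a≢q with suc a ≟ q
  ... | yes refl rewrite step-Hₘ-sₘ₋₁ q<n =
    q<n , a , 1≤a , n<1+n a , trans (cong σ (swap-self a)) σq≡j , just-after , larger-after-unmoved (n<1+n a) larger
    where
    just-after : ∀ r → a < r → r ≤ suc a → σ (swap a r) < j
    just-after r a<r r≤1+a rewrite ≤-antisym r≤1+a a<r | swap-suc a = subst (σ a <_) σq≡j up
  ... | no 1+a≢q rewrite step-Hₘ-other a≢q 1+a≢q =
    inj₁ (q<n , 1≤q , trans (cong σ (swap-other a (≢-sym a≢q) (≢-sym 1+a≢q))) σq≡j ,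
          larger-after-∘s 1≤a a<n 1≤q (≢-sym a≢q) larger)

  ascent-Hₙ : ∀ {σ a} → 1 ≤ a → a < n → σ a < σ (suc a) → NoLargerAfterJ σ → NoLargerAfterJ (σ ∘s a)
  ascent-Hₙ {σ} {a} 1≤a a<n up none x y 1≤x x<y y≤n σsx≡j j<σsy with swap-<-⊎ a x<y
  ... | inj₁ sx<sy =
    let (1≤sx , _) = swap-inRange 1≤a a<n 1≤x (<⇒≤ (<-≤-trans x<y y≤n))
        (_ , sy≤n) = swap-inRange 1≤a a<n (≤-trans 1≤x (<⇒≤ x<y)) y≤n in
    none (swap a x) (swap a y) 1≤sx sx<sy sy≤n σsx≡j j<σsy
  ... | inj₂ (refl , refl) =
    <-asym (subst (σ x <_) (trans (sym (cong σ (swap-self x))) σsx≡j) up) (subst (j <_) (cong σ (swap-suc x)) j<σsy)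

  ascent-I : ∀ {σ a m} → 1 ≤ a → a < n → σ a < σ (suc a) → a ≢ m → Good (I m) σ → Good (I m) (σ ∘s a)
  ascent-I {σ} {a} {m} 1≤a a<n up a≢m (m<n , p , 1≤p , p<m , σp≡j , smaller , larger) with a ≟ p
  ... | yes refl = contradiction (subst (_< σ (suc a)) σp≡j up) (<-asym (smaller (suc a) (n<1+n a) p<m))
  ... | no a≢p with suc a ≟ p
  ...   | yes refl = m<n , a , 1≤a , <-trans (n<1+n a) p<m , trans (cong σ (swap-self a)) σp≡j , smaller′ ,
                     larger-after-unmoved (<-trans (n<1+n a) p<m) larger
    where
    smaller′ : ∀ r → a < r → r ≤ m → σ (swap a r) < j
    smaller′ r a<r r≤m with r ≟ suc a
    ... | yes refl = subst (_< j) (sym (cong σ (swap-suc a))) (subst (σ a <_) σp≡j up)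
    ... | no r≢1+a = subst (_< j) (sym (cong σ (swap-other a (>⇒≢ a<r) r≢1+a))) (smaller r (≤∧≢⇒< a<r (≢-sym r≢1+a)) r≤m)
  ...   | no 1+a≢p = m<n , p , 1≤p , p<m , trans (cong σ (swap-other a (≢-sym a≢p) (≢-sym 1+a≢p))) σp≡j , smaller′ ,
                     larger-after-∘s 1≤a a<n (≤-trans 1≤p (<⇒≤ p<m)) (≢-sym a≢m) larger
    where
    smaller′ : ∀ r → p < r → r ≤ m → σ (swap a r) < j
    smaller′ r p<r r≤m = smaller (swap a r) (swap-above a (≢-sym a≢p) p<r) (swap-atMost a (≢-sym a≢m) r≤m)

  good-ascent : ∀ {σ S a} → Permutes n σ → 1 ≤ a → a < n → σ a < σ (suc a) → Good S σ →
                Good (stepU n S a) (σ ∘s a) ⊎ stepU n S a ≡ deadU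
  good-ascent {S = H q} P 1≤a a<n up (inj₁ (q<n , 1≤q , σq≡j , larger)) = inj₁ (ascent-H P 1≤a a<n up q<n 1≤q σq≡j larger)
  good-ascent {S = H q} {a} P 1≤a a<n up (inj₂ (refl , none)) rewrite step-Hₙ a = inj₁ (inj₂ (refl , ascent-Hₙ 1≤a a<n up none))
  good-ascent {S = I m} {a} P 1≤a a<n up good with a ≟ m
  ... | yes refl rewrite step-Iₘ-sₘ a = inj₂ refl
  ... | no a≢m rewrite step-Iₘ-other a≢m = inj₁ (ascent-I 1≤a a<n up a≢m good)

  good⇒avoids : ∀ {σ S} → Permutes n σ → Good S σ → ¬ Occurs n (PatternJKI j) σ
  good⇒avoids {S = H q} P (inj₁ (_ , _ , σq≡j , larger)) (x , y , z , _ , x<y , y<z , z≤last , σx≡j , _ , σz<j)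
    with injective P (trans σx≡j (sym σq≡j))
  ... | refl = <-asym σz<j (larger z (<-trans x<y y<z) z≤last)
  good⇒avoids {S = H q} P (inj₂ (_ , none)) (x , y , z , 1≤x , x<y , y<z , z≤last , σx≡j , j<σy , _) =
    none x y 1≤x x<y (<⇒≤ (<-≤-trans y<z z≤last)) σx≡j j<σy
  good⇒avoids {S = I m} P (_ , p , _ , _ , σp≡j , smaller , larger) (x , y , z , _ , x<y , y<z , z≤last , σx≡j , j<σy , σz<j)
    with injective P (trans σx≡j (sym σp≡j))
  ... | refl with y ≤? m
  ...   | yes y≤m = <-asym j<σy (smaller y x<y y≤m)
  ...   | no y≰m = <-asym σz<j (larger z (<-trans (≰⇒> y≰m) y<z) z≤last)

  good⇒alive : ∀ {σ S} → Good S σ → S ≢ deadU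
  good⇒alive {S = H _} _ ()
  good⇒alive {S = I _} _ ()

  good-identity : ∀ {σ S} → AgreeOn n σ (λ x → x) → Good S σ → S ≡ H j
  good-identity {S = H q} σ≈id (inj₁ (q<n , 1≤q , σq≡j , _)) = cong H (trans (sym (σ≈id q 1≤q (<⇒≤ q<n))) σq≡j)
  good-identity {S = H q} σ≈id (inj₂ (_ , none)) =
    contradiction (subst (j <_) (sym (σ≈id n (≤-trans 1≤j (<⇒≤ j<n)) ≤-refl)) j<n) (none j n 1≤j j<n ≤-refl (σ≈id j 1≤j (<⇒≤ j<n)))
  good-identity {S = I m} σ≈id (m<n , p , 1≤p , p<m , σp≡j , smaller , _) =
    let p≡j = trans (sym (σ≈id p 1≤p (<⇒≤ (<-trans p<m m<n)))) σp≡j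
        m<j = subst (_< j) (σ≈id m (≤-trans 1≤p (<⇒≤ p<m)) (<⇒≤ m<n)) (smaller m p<m ≤-refl) in
    contradiction (subst (_< m) p≡j p<m) (<-asym m<j)

  compare-j : ∀ {σ p r} → Permutes n σ → σ p ≡ j → r ≢ p → σ r < j ⊎ j < σ r
  compare-j {σ} {p} {r} P σp≡j r≢p with <-cmp (σ r) j
  ... | tri< σr<j _ _ = inj₁ σr<j
  ... | tri≈ _ σr≡j _ = contradiction (injective P (trans σr≡j (sym σp≡j))) r≢p
  ... | tri> _ _ j<σr = inj₂ j<σr

  larger-after-of : ∀ {σ p m} → Permutes n σ → σ p ≡ j → p ≤ m →
                    (∀ r → m < r → r ≤ n → ¬ σ r < j) → LargerAfter m σ
  larger-after-of P σp≡j p≤m not-smaller r m<r r≤n with compare-j P σp≡j (>⇒≢ (≤-<-trans p≤m m<r))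
  ... | inj₁ σr<j = contradiction σr<j (not-smaller r m<r r≤n)
  ... | inj₂ j<σr = j<σr

  good-of-j-last : ∀ {σ p} → Permutes n σ → 1 ≤ p → p ≤ n → σ p ≡ j →
                   (∀ r → p < r → r ≤ n → ¬ σ r < j) → ∃ λ S → Good S σ
  good-of-j-last {σ} {p} P 1≤p p≤n σp≡j not-smaller with p <? n
  ... | yes p<n = H p , inj₁ (p<n , 1≤p , σp≡j , larger-after-of P σp≡j ≤-refl not-smaller)
  ... | no p≮n = H p , inj₂ (p≡n , λ x y _ x<y y≤n σx≡j _ →
                   <-irrefl refl (≤-trans (subst (_< y) (trans (injective P (trans σx≡j (sym σp≡j))) p≡n) x<y) y≤n))
    where
    p≡n : p ≡ n
    p≡n = ≤-antisym p≤n (≮⇒≥ p≮n)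

  good-of-last-smaller : ∀ {σ p m} → Permutes n σ → ¬ Occurs n (PatternJKI j) σ → 1 ≤ p → σ p ≡ j →
                         p < m → m ≤ n → σ m < j → (∀ r → m < r → r ≤ n → ¬ σ r < j) → ∃ λ S → Good S σ
  good-of-last-smaller {σ} {p} {m} P avoids 1≤p σp≡j p<m m≤n σm<j not-smaller with m <? n
  ... | yes m<n = I m , m<n , p , 1≤p , p<m , σp≡j , smaller , larger-after-of P σp≡j (<⇒≤ p<m) not-smaller
    where
    smaller : ∀ r → p < r → r ≤ m → σ r < j
    smaller r p<r r≤m with r ≟ m | compare-j P σp≡j (>⇒≢ p<r)
    ... | yes refl | _ = σm<j
    ... | no _ | inj₁ σr<j = σr<j
    ... | no r≢m | inj₂ j<σr = contradiction (p , r , m , 1≤p , p<r , ≤∧≢⇒< r≤m r≢m , m≤n , σp≡j , j<σr , σm<j) avoids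
  ... | no m≮n = H n , inj₂ (refl , no-larger)
    where
    no-larger : NoLargerAfterJ σ
    no-larger x y 1≤x x<y y≤n σx≡j j<σy with injective P (trans σx≡j (sym σp≡j)) | y ≟ m
    ... | refl | yes refl = <-asym σm<j j<σy
    ... | refl | no y≢m =
      avoids (x , y , m , 1≤x , x<y , ≤∧≢⇒< (subst (y ≤_) (≤-antisym (≮⇒≥ m≮n) m≤n) y≤n) y≢m , m≤n , σx≡j , j<σy , σm<j)

  avoids⇒good : ∀ {σ} → Permutes n σ → ¬ Occurs n (PatternJKI j) σ → ∃ λ S → Good S σ
  avoids⇒good {σ} P avoids with σ⁻¹-inRange P 1≤j (<⇒≤ j<n) | greatest≤ (λ z → (σ⁻¹ P j <? z) ×-dec (σ z <? j)) n
  ... | 1≤p , p≤n | inj₂ none = good-of-j-last P 1≤p p≤n (inverseʳ P j) (λ r p<r r≤n σr<j → none r r≤n (p<r , σr<j))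
  ... | 1≤p , _ | inj₁ (m , m≤n , (p<m , σm<j) , maximal) =
    good-of-last-smaller P avoids 1≤p (inverseʳ P j) p<m m≤n σm<j
      (λ r m<r r≤n σr<j → maximal r m<r r≤n (<-trans p<m m<r , σr<j))

  Predecessor : UState → (ℕ → ℕ) → Set
  Predecessor S σ = Σ ℕ λ a → Σ UState λ S′ → 1 ≤ a × a < n × σ (suc a) < σ a × Good S′ (σ ∘s a) × stepU n S′ a ≡ S

  descent-H : ∀ {σ d q} → 1 ≤ d → d < n → σ (suc d) < σ d →
              q < n → 1 ≤ q → σ q ≡ j → LargerAfter q σ → Predecessor (H q) σ
  descent-H {σ} {d} {q} 1≤d d<n down q<n 1≤q σq≡j larger with suc d ≟ q
  ... | yes refl = d , H d , 1≤d , d<n , down ,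
          inj₁ (d<n , 1≤d , trans (cong σ (swap-self d)) σq≡j , larger′) , step-Hₘ-sₘ d<n
    where
    larger′ : LargerAfter d (σ ∘s d)
    larger′ r d<r r≤n with r ≟ suc d
    ... | yes refl = subst (j <_) (sym (cong σ (swap-suc d))) (subst (_< σ d) σq≡j down)
    ... | no r≢1+d = larger-after-unmoved (n<1+n d) larger r (≤∧≢⇒< d<r (≢-sym r≢1+d)) r≤n
  ... | no 1+d≢q with d ≟ q
  ...   | yes refl = contradiction (subst (_< σ (suc d)) (sym σq≡j) (larger (suc d) (n<1+n d) q<n)) (<-asym down)
  ...   | no d≢q = d , H q , 1≤d , d<n , down ,
          inj₁ (q<n , 1≤q , trans (cong σ (swap-other d (≢-sym d≢q) (≢-sym 1+d≢q))) σq≡j ,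
                larger-after-∘s 1≤d d<n 1≤q (≢-sym d≢q) larger) ,
          step-Hₘ-other d≢q 1+d≢q

  descent-Hₙ : ∀ {σ d} → Permutes n σ → 1 ≤ d → d < n → σ (suc d) < σ d → NoLargerAfterJ σ → Predecessor (H n) σ
  descent-Hₙ {σ} {d} P 1≤d d<n down none with σ⁻¹-inRange P 1≤j (<⇒≤ j<n) | inverseʳ P j | σ⁻¹ P j <? n
  ... | 1≤p , _ | σp≡j | yes p<n = p , H n , 1≤p , p<n , down′ , inj₂ (refl , none′) , step-Hₙ p
    where
    p = σ⁻¹ P j
    down′ : σ (suc p) < σ p
    down′ with compare-j P σp≡j (1+n≢n {p})
    ... | inj₁ σ1+p<j = subst (σ (suc p) <_) (sym σp≡j) σ1+p<j
    ... | inj₂ j<σ1+p = contradiction j<σ1+p (none p (suc p) 1≤p (n<1+n p) p<n σp≡j)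
    none′ : NoLargerAfterJ (σ ∘s p)
    none′ x y _ x<y y≤n σsx≡j j<σsy
      with injective (∘swap-permutes 1≤p p<n P) {x} {suc p} (trans σsx≡j (sym (trans (cong σ (swap-suc p)) σp≡j)))
    ... | refl = none p y 1≤p (<-trans (n<1+n p) x<y) y≤n σp≡j
                   (subst (j <_) (cong σ (swap-other p (>⇒≢ (<-trans (n<1+n p) x<y)) (>⇒≢ x<y))) j<σsy)
  ... | _ , p≤n | σp≡j | no p≮n with suc d ≟ n
  ...   | yes 1+d≡n = d , H d , 1≤d , d<n , down , inj₁ (d<n , 1≤d , trans (cong σ (swap-self d)) σ1+d≡j , larger′) ,
                      trans (step-Hₘ-sₘ d<n) (cong H 1+d≡n)
    where
    σ1+d≡j : σ (suc d) ≡ j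
    σ1+d≡j = trans (cong σ (trans 1+d≡n (sym (≤-antisym p≤n (≮⇒≥ p≮n))))) σp≡j
    larger′ : LargerAfter d (σ ∘s d)
    larger′ r d<r r≤n rewrite ≤-antisym (subst (r ≤_) (sym 1+d≡n) r≤n) d<r | swap-suc d = subst (_< σ d) σ1+d≡j down
  ...   | no 1+d≢n = d , H n , 1≤d , d<n , down , inj₂ (refl , none′) , step-Hₙ d
    where
    σn≡j : σ (swap d n) ≡ j
    σn≡j = trans (cong σ (trans (swap-other d (>⇒≢ d<n) (≢-sym 1+d≢n)) (sym (≤-antisym p≤n (≮⇒≥ p≮n))))) σp≡j
    none′ : NoLargerAfterJ (σ ∘s d)
    none′ x y _ x<y y≤n σsx≡j _ with injective (∘swap-permutes 1≤d d<n P) {x} {n} (trans σsx≡j (sym σn≡j))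
    ... | refl = <-irrefl refl (<-≤-trans x<y y≤n)

  descent-I : ∀ {σ m} → Good (I m) σ → Predecessor (I m) σ
  descent-I {σ} {m} (m<n , p , 1≤p , p<m , σp≡j , smaller , larger) = p , S′ , 1≤p , <-trans p<m m<n , down , good′ , step≡
    where
    down : σ (suc p) < σ p
    down = subst (σ (suc p) <_) (sym σp≡j) (smaller (suc p) (n<1+n p) p<m)
    S′ : UState
    S′ with suc p ≟ m
    ... | yes _ = H m
    ... | no _ = I m
    good′ : Good S′ (σ ∘s p)
    good′ with suc p ≟ m
    ... | yes refl = inj₁ (m<n , s≤s z≤n , trans (cong σ (swap-suc p)) σp≡j , larger-after-unmoved (n<1+n p) larger)
    ... | no 1+p≢m = m<n , suc p , s≤s z≤n , ≤∧≢⇒< p<m 1+p≢m , trans (cong σ (swap-suc p)) σp≡j , smaller′ ,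
                     larger-after-unmoved p<m larger
      where
      smaller′ : ∀ r → suc p < r → r ≤ m → σ (swap p r) < j
      smaller′ r 1+p<r r≤m =
        subst (_< j) (sym (cong σ (swap-other p (>⇒≢ (<-trans (n<1+n p) 1+p<r)) (>⇒≢ 1+p<r)))) (smaller r (<-trans (n<1+n p) 1+p<r) r≤m)
    step≡ : stepU n S′ p ≡ I m
    step≡ with suc p ≟ m
    ... | yes refl = step-Hₘ-sₘ₋₁ m<n
    ... | no _ = step-Iₘ-other (<⇒≢ p<m)

  good-descent : ∀ {σ S d} → Permutes n σ → Good S σ → 1 ≤ d → d < n → σ (suc d) < σ d → Predecessor S σ
  good-descent {S = H q} P (inj₁ (q<n , 1≤q , σq≡j , larger)) 1≤d d<n down = descent-H 1≤d d<n down q<n 1≤q σq≡j larger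
  good-descent {S = H q} P (inj₂ (refl , none)) 1≤d d<n down = descent-Hₙ P 1≤d d<n down none
  good-descent {S = I m} P good _ _ _ = descent-I good

  accepted-reduced⇔avoids : ∀ {σ} → Permutes n σ →
    (∃ λ w → ReducedOn n w σ × ¬ runU n j w ≡ deadU) ⇔ (¬ Occurs n (PatternJKI j) σ)
  accepted-reduced⇔avoids = Criterion.accepted-reduced⇔avoids n (stepU n) (H j) deadU
    (λ σ → ¬ Occurs n (PatternJKI j) σ) (avoids-cong n (PatternJKI j)) Good
    (λ _ → refl) good-start good-ascent good⇒avoids good⇒alive avoids⇒good good-descent good-identity

module AutomatonD (n j : ℕ) (2≤j : 2 ≤ j) (j<n : j < n) where

  1≤j : 1 ≤ j
  1≤j = ≤-trans (s≤s z≤n) 2≤j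

  step-Gₘ-sₘ₋₁ : ∀ {a} → 1 ≤ a → stepD (G (suc a)) a ≡ G a
  step-Gₘ-sₘ₋₁ {suc m} _ rewrite ≡ᵇ-refl m = refl

  step-Gₘ-sₘ : ∀ {q} → 2 ≤ q → stepD (G q) q ≡ J q
  step-Gₘ-sₘ {suc zero} (s≤s ())
  step-Gₘ-sₘ {suc (suc m)} _ rewrite ≢⇒≡ᵇ-false (1+n≢n {suc (suc m)}) | ≡ᵇ-refl m = refl

  step-Gₘ-other : ∀ {q a} → suc a ≢ q → a ≢ q → stepD (G q) a ≡ G q
  step-Gₘ-other {zero} _ _ = refl
  step-Gₘ-other {suc zero} _ _ = refl
  step-Gₘ-other {suc (suc m)} 1+a≢q a≢q rewrite ≢⇒≡ᵇ-false 1+a≢q | ≢⇒≡ᵇ-false a≢q = refl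

  step-Jₘ-sₘ₋₁ : ∀ a → stepD (J (suc a)) a ≡ deadD
  step-Jₘ-sₘ₋₁ a rewrite ≡ᵇ-refl a = refl

  step-Jₘ-other : ∀ {m a} → suc a ≢ m → stepD (J m) a ≡ J m
  step-Jₘ-other 1+a≢m rewrite ≢⇒≡ᵇ-false 1+a≢m = refl

  SmallerBefore : ℕ → (ℕ → ℕ) → Set
  SmallerBefore m σ = ∀ r → 1 ≤ r → r < m → σ r < j

  NoSmallerBeforeJ : (ℕ → ℕ) → Set
  NoSmallerBeforeJ σ = ∀ x y → 1 ≤ x → x < y → y ≤ n → σ y ≡ j → ¬ σ x < j

  Good : DState → (ℕ → ℕ) → Set
  Good (G q) σ = (2 ≤ q × q ≤ n × σ q ≡ j × SmallerBefore q σ) ⊎ (q ≡ 1 × NoSmallerBeforeJ σ)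
  Good (J m) σ = 2 ≤ m × Σ ℕ λ p → m < p × p ≤ n × σ p ≡ j × (∀ r → m ≤ r → r < p → j < σ r) × SmallerBefore m σ
  Good deadD σ = ⊥

  good-start : Good (G j) (λ x → x)
  good-start = inj₁ (2≤j , <⇒≤ j<n , refl , λ _ _ r<j → r<j)

  smaller-before-∘s : ∀ {σ a m} → 1 ≤ a → a < n → m ≤ n → m ≢ suc a → SmallerBefore m σ → SmallerBefore m (σ ∘s a)
  smaller-before-∘s {a = a} 1≤a a<n m≤n m≢1+a smaller r 1≤r r<m =
    smaller (swap a r) (proj₁ (swap-inRange 1≤a a<n 1≤r (≤-trans (<⇒≤ r<m) m≤n))) (swap-below a m≢1+a r<m)

  smaller-before-unmoved : ∀ {σ a m} → m ≤ a → SmallerBefore m σ → SmallerBefore m (σ ∘s a)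
  smaller-before-unmoved {σ} {a} m≤a smaller r 1≤r r<m =
    subst (_< j) (sym (cong σ (swap-other a (<⇒≢ (<-≤-trans r<m m≤a)) (<⇒≢ (<-≤-trans r<m (m≤n⇒m≤1+n m≤a))))))
          (smaller r 1≤r r<m)

  ascent-G : ∀ {σ a q} → Permutes n σ → 1 ≤ a → a < n → σ a < σ (suc a) →
             2 ≤ q → q ≤ n → σ q ≡ j → SmallerBefore q σ → Good (stepD (G q) a) (σ ∘s a)
  ascent-G {σ} {a} {q} P 1≤a a<n up 2≤q q≤n σq≡j smaller with suc a ≟ q
  ... | yes refl rewrite step-Gₘ-sₘ₋₁ 1≤a with 2 ≤? a
  ...   | yes 2≤a = inj₁ (2≤a , <⇒≤ a<n , trans (cong σ (swap-self a)) σq≡j ,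
                          smaller-before-unmoved ≤-refl (λ r 1≤r r<a → smaller r 1≤r (<-trans r<a (n<1+n a))))
  ...   | no 2≰a = inj₂ (a≡1 , λ x y 1≤x x<y _ σsy≡j _ →
                          let y≡a = injective (∘swap-permutes 1≤a a<n P) {y} {a} (trans σsy≡j (sym (trans (cong σ (swap-self a)) σq≡j))) in
                          <-irrefl refl (≤-trans (subst (x <_) (trans y≡a a≡1) x<y) 1≤x))
    where
    a≡1 : a ≡ 1
    a≡1 = ≤-antisym (≤-pred (≰⇒> 2≰a)) 1≤a
  ascent-G {σ} {a} {q} P 1≤a a<n up 2≤q q≤n σq≡j smaller | no 1+a≢q with a ≟ q
  ... | yes refl rewrite step-Gₘ-sₘ 2≤q =
    2≤q , suc a , n<1+n a , a<n , trans (cong σ (swap-suc a)) σq≡j , just-before , smaller-before-unmoved ≤-refl smaller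
    where
    just-before : ∀ r → a ≤ r → r < suc a → j < σ (swap a r)
    just-before r a≤r r<1+a with ≤-antisym (≤-pred r<1+a) a≤r
    ... | refl = subst (j <_) (sym (cong σ (swap-self a))) (subst (_< σ (suc a)) σq≡j up)
  ... | no a≢q rewrite step-Gₘ-other 1+a≢q a≢q =
    inj₁ (2≤q , q≤n , trans (cong σ (swap-other a (≢-sym a≢q) (≢-sym 1+a≢q))) σq≡j ,
          smaller-before-∘s 1≤a a<n q≤n (≢-sym 1+a≢q) smaller)

  ascent-G₁ : ∀ {σ a} → 1 ≤ a → a < n → σ a < σ (suc a) → NoSmallerBeforeJ σ → NoSmallerBeforeJ (σ ∘s a)
  ascent-G₁ {σ} {a} 1≤a a<n up none x y 1≤x x<y y≤n σsy≡j σsx<j with swap-<-⊎ a x<y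
  ... | inj₁ sx<sy =
    let (1≤sx , _) = swap-inRange 1≤a a<n 1≤x (<⇒≤ (<-≤-trans x<y y≤n))
        (_ , sy≤n) = swap-inRange 1≤a a<n (≤-trans 1≤x (<⇒≤ x<y)) y≤n in
    none (swap a x) (swap a y) 1≤sx sx<sy sy≤n σsy≡j σsx<j
  ... | inj₂ (refl , refl) =
    <-asym up (subst (σ (suc x) <_) (trans (sym σsy≡j) (cong σ (swap-suc x))) (subst (_< j) (cong σ (swap-self x)) σsx<j))

  ascent-J : ∀ {σ a m} → 1 ≤ a → a < n → σ a < σ (suc a) → suc a ≢ m → Good (J m) σ → Good (J m) (σ ∘s a)
  ascent-J {σ} {a} {m} 1≤a a<n up 1+a≢m (2≤m , p , m<p , p≤n , σp≡j , larger , smaller) with suc a ≟ p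
  ... | yes refl = contradiction (subst (σ a <_) σp≡j up) (<-asym (larger a (≤-pred m<p) (n<1+n a)))
  ... | no 1+a≢p with a ≟ p
  ...   | yes refl = 2≤m , suc a , <-trans m<p (n<1+n a) , a<n , trans (cong σ (swap-suc a)) σp≡j , larger′ ,
                     smaller-before-unmoved (<⇒≤ m<p) smaller
    where
    larger′ : ∀ r → m ≤ r → r < suc a → j < σ (swap a r)
    larger′ r m≤r r<1+a with r ≟ a
    ... | yes refl = subst (j <_) (sym (cong σ (swap-self a))) (subst (_< σ (suc a)) σp≡j up)
    ... | no r≢a = subst (j <_) (sym (cong σ (swap-other a r≢a (<⇒≢ r<1+a)))) (larger r m≤r (≤∧≢⇒< (≤-pred r<1+a) r≢a))
  ...   | no a≢p = 2≤m , p , m<p , p≤n , trans (cong σ (swap-other a (≢-sym a≢p) (≢-sym 1+a≢p))) σp≡j , larger′ ,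
                   smaller-before-∘s 1≤a a<n (≤-trans (<⇒≤ m<p) p≤n) (≢-sym 1+a≢m) smaller
    where
    larger′ : ∀ r → m ≤ r → r < p → j < σ (swap a r)
    larger′ r m≤r r<p = larger (swap a r) (swap-atLeast a (≢-sym 1+a≢m) m≤r) (swap-below a (≢-sym 1+a≢p) r<p)

  good-ascent : ∀ {σ S a} → Permutes n σ → 1 ≤ a → a < n → σ a < σ (suc a) → Good S σ →
                Good (stepD S a) (σ ∘s a) ⊎ stepD S a ≡ deadD
  good-ascent {S = G q} P 1≤a a<n up (inj₁ (2≤q , q≤n , σq≡j , smaller)) = inj₁ (ascent-G P 1≤a a<n up 2≤q q≤n σq≡j smaller)
  good-ascent {S = G q} P 1≤a a<n up (inj₂ (refl , none)) = inj₁ (inj₂ (refl , ascent-G₁ 1≤a a<n up none))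
  good-ascent {S = J m} {a} P 1≤a a<n up good with suc a ≟ m
  ... | yes refl rewrite step-Jₘ-sₘ₋₁ a = inj₂ refl
  ... | no 1+a≢m rewrite step-Jₘ-other 1+a≢m = inj₁ (ascent-J 1≤a a<n up 1+a≢m good)

  good⇒avoids : ∀ {σ S} → Permutes n σ → Good S σ → ¬ Occurs n (PatternKIJ j) σ
  good⇒avoids {S = G q} P (inj₁ (_ , _ , σq≡j , smaller)) (x , y , z , 1≤x , x<y , y<z , _ , j<σx , _ , σz≡j)
    with injective P (trans σz≡j (sym σq≡j))
  ... | refl = <-asym j<σx (smaller x 1≤x (<-trans x<y y<z))
  good⇒avoids {S = G q} P (inj₂ (_ , none)) (x , y , z , 1≤x , x<y , y<z , z≤last , _ , σy<j , σz≡j) =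
    none y z (≤-trans 1≤x (<⇒≤ x<y)) y<z z≤last σz≡j σy<j
  good⇒avoids {S = J m} P (_ , p , _ , _ , σp≡j , larger , smaller) (x , y , z , 1≤x , x<y , y<z , _ , j<σx , σy<j , σz≡j)
    with injective P (trans σz≡j (sym σp≡j))
  ... | refl with m ≤? y
  ...   | yes m≤y = <-asym σy<j (larger y m≤y y<z)
  ...   | no m≰y = <-asym j<σx (smaller x 1≤x (<-trans x<y (≰⇒> m≰y)))

  good⇒alive : ∀ {σ S} → Good S σ → S ≢ deadD
  good⇒alive {S = G _} _ ()
  good⇒alive {S = J _} _ ()

  good-identity : ∀ {σ S} → AgreeOn n σ (λ x → x) → Good S σ → S ≡ G j
  good-identity {S = G q} σ≈id (inj₁ (2≤q , q≤n , σq≡j , _)) = cong G (trans (sym (σ≈id q (≤-trans (s≤s z≤n) 2≤q) q≤n)) σq≡j)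
  good-identity {S = G q} σ≈id (inj₂ (_ , none)) =
    contradiction (subst (_< j) (sym (σ≈id 1 ≤-refl (≤-trans 1≤j (<⇒≤ j<n)))) 2≤j)
                  (none 1 j ≤-refl 2≤j (<⇒≤ j<n) (σ≈id j 1≤j (<⇒≤ j<n)))
  good-identity {S = J m} σ≈id (2≤m , p , m<p , p≤n , σp≡j , larger , _) =
    let p≡j = trans (sym (σ≈id p (≤-trans (s≤s z≤n) (≤-trans 2≤m (<⇒≤ m<p))) p≤n)) σp≡j
        j<m = subst (j <_) (σ≈id m (≤-trans (s≤s z≤n) 2≤m) (≤-trans (<⇒≤ m<p) p≤n)) (larger m ≤-refl m<p) in
    contradiction (subst (m <_) p≡j m<p) (<-asym j<m)

  compare-j : ∀ {σ p r} → Permutes n σ → σ p ≡ j → r ≢ p → σ r < j ⊎ j < σ r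
  compare-j {σ} {p} {r} P σp≡j r≢p with <-cmp (σ r) j
  ... | tri< σr<j _ _ = inj₁ σr<j
  ... | tri≈ _ σr≡j _ = contradiction (injective P (trans σr≡j (sym σp≡j))) r≢p
  ... | tri> _ _ j<σr = inj₂ j<σr

  smaller-before-of : ∀ {σ p m} → Permutes n σ → σ p ≡ j → m ≤ p →
                      (∀ r → 1 ≤ r → r < m → ¬ j < σ r) → SmallerBefore m σ
  smaller-before-of P σp≡j m≤p not-larger r 1≤r r<m with compare-j P σp≡j (<⇒≢ (<-≤-trans r<m m≤p))
  ... | inj₁ σr<j = σr<j
  ... | inj₂ j<σr = contradiction j<σr (not-larger r 1≤r r<m)

  no-smaller-before-1 : ∀ {σ p} → Permutes n σ → σ p ≡ j → p ≤ 1 → NoSmallerBeforeJ σ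
  no-smaller-before-1 P σp≡j p≤1 x y 1≤x x<y _ σy≡j _ =
    <-irrefl refl (≤-trans (subst (x <_) (injective P (trans σy≡j (sym σp≡j))) x<y) (≤-trans p≤1 1≤x))

  good-of-j-first : ∀ {σ p} → Permutes n σ → 1 ≤ p → p ≤ n → σ p ≡ j →
                    (∀ r → 1 ≤ r → r < p → ¬ j < σ r) → ∃ λ S → Good S σ
  good-of-j-first {σ} {p} P 1≤p p≤n σp≡j not-larger with 2 ≤? p
  ... | yes 2≤p = G p , inj₁ (2≤p , p≤n , σp≡j , smaller-before-of P σp≡j ≤-refl not-larger)
  ... | no 2≰p = G 1 , inj₂ (refl , no-smaller-before-1 P σp≡j (≤-pred (≰⇒> 2≰p)))

  good-of-first-larger : ∀ {σ p m} → Permutes n σ → ¬ Occurs n (PatternKIJ j) σ → p ≤ n → σ p ≡ j →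
                         1 ≤ m → m < p → j < σ m → (∀ r → 1 ≤ r → r < m → ¬ j < σ r) → ∃ λ S → Good S σ
  good-of-first-larger {σ} {p} {m} P avoids p≤n σp≡j 1≤m m<p j<σm not-larger with 2 ≤? m
  ... | yes 2≤m = J m , 2≤m , p , m<p , p≤n , σp≡j , larger , smaller-before-of P σp≡j (<⇒≤ m<p) not-larger
    where
    larger : ∀ r → m ≤ r → r < p → j < σ r
    larger r m≤r r<p with r ≟ m | compare-j P σp≡j (<⇒≢ r<p)
    ... | yes refl | _ = j<σm
    ... | no _ | inj₂ j<σr = j<σr
    ... | no r≢m | inj₁ σr<j = contradiction (m , r , p , 1≤m , ≤∧≢⇒< m≤r (≢-sym r≢m) , r<p , p≤n , j<σm , σr<j , σp≡j) avoids
  ... | no 2≰m = G 1 , inj₂ (refl , no-smaller)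
    where
    m≡1 : m ≡ 1
    m≡1 = ≤-antisym (≤-pred (≰⇒> 2≰m)) 1≤m
    no-smaller : NoSmallerBeforeJ σ
    no-smaller x y 1≤x x<y _ σy≡j σx<j with injective P (trans σy≡j (sym σp≡j)) | x ≟ m
    ... | refl | yes refl = <-asym σx<j j<σm
    ... | refl | no x≢m =
      avoids (m , x , y , 1≤m , ≤∧≢⇒< (subst (_≤ x) (sym m≡1) 1≤x) (≢-sym x≢m) , x<y , p≤n , j<σm , σx<j , σy≡j)

  avoids⇒good : ∀ {σ} → Permutes n σ → ¬ Occurs n (PatternKIJ j) σ → ∃ λ S → Good S σ
  avoids⇒good {σ} P avoids
    with σ⁻¹-inRange P 1≤j (<⇒≤ j<n) | least≤ (λ z → (1 ≤? z) ×-dec ((z <? σ⁻¹ P j) ×-dec (j <? σ z))) n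
  ... | 1≤p , p≤n | inj₂ none =
    good-of-j-first P 1≤p p≤n (inverseʳ P j) (λ r 1≤r r<p j<σr → none r (≤-trans (<⇒≤ r<p) p≤n) (1≤r , r<p , j<σr))
  ... | _ , p≤n | inj₁ (m , _ , (1≤m , m<p , j<σm) , minimal) =
    good-of-first-larger P avoids p≤n (inverseʳ P j) 1≤m m<p j<σm
      (λ r 1≤r r<m j<σr → minimal r r<m (1≤r , <-trans r<m m<p , j<σr))

  Predecessor : DState → (ℕ → ℕ) → Set
  Predecessor S σ = Σ ℕ λ a → Σ DState λ S′ → 1 ≤ a × a < n × σ (suc a) < σ a × Good S′ (σ ∘s a) × stepD S′ a ≡ S

  descent-G : ∀ {σ d q} → 1 ≤ d → d < n → σ (suc d) < σ d →
              2 ≤ q → q ≤ n → σ q ≡ j → SmallerBefore q σ → Predecessor (G q) σ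
  descent-G {σ} {d} {q} 1≤d d<n down 2≤q q≤n σq≡j smaller with d ≟ q
  ... | yes refl = d , G (suc d) , 1≤d , d<n , down ,
          inj₁ (s≤s 1≤d , d<n , trans (cong σ (swap-suc d)) σq≡j , smaller′) , step-Gₘ-sₘ₋₁ 1≤d
    where
    smaller′ : SmallerBefore (suc d) (σ ∘s d)
    smaller′ r 1≤r r<1+d with r ≟ d
    ... | yes refl = subst (_< j) (sym (cong σ (swap-self d))) (subst (σ (suc d) <_) σq≡j down)
    ... | no r≢d = smaller-before-unmoved ≤-refl smaller r 1≤r (≤∧≢⇒< (≤-pred r<1+d) r≢d)
  ... | no d≢q with suc d ≟ q
  ...   | yes refl = contradiction (subst (σ d <_) (sym σq≡j) (smaller d 1≤d (n<1+n d))) (<-asym down)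
  ...   | no 1+d≢q = d , G q , 1≤d , d<n , down ,
          inj₁ (2≤q , q≤n , trans (cong σ (swap-other d (≢-sym d≢q) (≢-sym 1+d≢q))) σq≡j ,
                smaller-before-∘s 1≤d d<n q≤n (≢-sym 1+d≢q) smaller) ,
          step-Gₘ-other 1+d≢q d≢q

  descent-G₁ : ∀ {σ d} → Permutes n σ → 1 ≤ d → d < n → σ (suc d) < σ d → NoSmallerBeforeJ σ → Predecessor (G 1) σ
  descent-G₁ {σ} {d} P 1≤d d<n down none with σ⁻¹-inRange P 1≤j (<⇒≤ j<n) | inverseʳ P j
  ... | 1≤p , p≤n | σp≡j = predecessor (σ⁻¹ P j) 1≤p p≤n σp≡j
    where
    predecessor : ∀ p → 1 ≤ p → p ≤ n → σ p ≡ j → Predecessor (G 1) σ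
    predecessor (suc (suc a)) _ p≤n σp≡j = suc a , G 1 , s≤s z≤n , p≤n , down′ , inj₂ (refl , none′) , refl
      where
      down′ : σ (suc (suc a)) < σ (suc a)
      down′ with compare-j P σp≡j (≢-sym (1+n≢n {suc a}))
      ... | inj₁ σ1+a<j = contradiction σ1+a<j (none (suc a) (suc (suc a)) (s≤s z≤n) (n<1+n (suc a)) p≤n σp≡j)
      ... | inj₂ j<σ1+a = subst (_< σ (suc a)) (sym σp≡j) j<σ1+a
      none′ : NoSmallerBeforeJ (σ ∘s suc a)
      none′ x y 1≤x x<y _ σsy≡j σsx<j
        with injective (∘swap-permutes (s≤s z≤n) p≤n P) {y} {suc a} (trans σsy≡j (sym (trans (cong σ (swap-self (suc a))) σp≡j)))
      ... | refl = none x (suc (suc a)) 1≤x (<-trans x<y (n<1+n (suc a))) p≤n σp≡j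
                     (subst (_< j) (cong σ (swap-other (suc a) (<⇒≢ x<y) (<⇒≢ (<-trans x<y (n<1+n (suc a)))))) σsx<j)
    predecessor (suc zero) _ _ σ1≡j with d ≟ 1
    ... | yes refl = 1 , G 2 , ≤-refl , d<n , down , inj₁ (≤-refl , d<n , trans (cong σ (swap-suc 1)) σ1≡j , smaller′) , refl
      where
      smaller′ : SmallerBefore 2 (σ ∘s 1)
      smaller′ (suc zero) _ _ = subst (σ 2 <_) σ1≡j down
      smaller′ (suc (suc r)) _ (s≤s (s≤s ()))
    ... | no d≢1 = d , G 1 , 1≤d , d<n , down , inj₂ (refl , none′) , refl
      where
      none′ : NoSmallerBeforeJ (σ ∘s d)
      none′ x y 1≤x x<y _ σsy≡j _
        with injective (∘swap-permutes 1≤d d<n P) {y} {1}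
               (trans σsy≡j (sym (trans (cong σ (swap-other d (≢-sym d≢1) (<⇒≢ (s≤s 1≤d)))) σ1≡j)))
      ... | refl = <-irrefl refl (≤-trans x<y 1≤x)

  descent-J : ∀ {σ m} → Good (J m) σ → Predecessor (J m) σ
  descent-J {σ} {m} (2≤m , suc a , m<p , p≤n , σp≡j , larger , smaller) with a ≟ m
  ... | yes refl = a , G a , ≤-trans (s≤s z≤n) 2≤m , p≤n , down ,
          inj₁ (2≤m , <⇒≤ p≤n , trans (cong σ (swap-self a)) σp≡j , smaller-before-unmoved ≤-refl smaller) , step-Gₘ-sₘ 2≤m
    where
    down : σ (suc a) < σ a
    down = subst (_< σ a) (sym σp≡j) (larger a ≤-refl (n<1+n a))
  ... | no a≢m = a , J m , ≤-trans (s≤s z≤n) (≤-trans 2≤m m≤a) , p≤n , down ,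
          (2≤m , a , m<a , <⇒≤ p≤n , trans (cong σ (swap-self a)) σp≡j , larger′ , smaller-before-unmoved m≤a smaller) ,
          step-Jₘ-other (>⇒≢ m<p)
    where
    m≤a : m ≤ a
    m≤a = ≤-pred m<p
    m<a : m < a
    m<a = ≤∧≢⇒< m≤a (≢-sym a≢m)
    down : σ (suc a) < σ a
    down = subst (_< σ a) (sym σp≡j) (larger a m≤a (n<1+n a))
    larger′ : ∀ r → m ≤ r → r < a → j < σ (swap a r)
    larger′ r m≤r r<a =
      subst (j <_) (sym (cong σ (swap-other a (<⇒≢ r<a) (<⇒≢ (<-trans r<a (n<1+n a)))))) (larger r m≤r (<-trans r<a (n<1+n a)))

  good-descent : ∀ {σ S d} → Permutes n σ → Good S σ → 1 ≤ d → d < n → σ (suc d) < σ d → Predecessor S σ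
  good-descent {S = G q} P (inj₁ (2≤q , q≤n , σq≡j , smaller)) 1≤d d<n down = descent-G 1≤d d<n down 2≤q q≤n σq≡j smaller
  good-descent {S = G q} P (inj₂ (refl , none)) 1≤d d<n down = descent-G₁ P 1≤d d<n down none
  good-descent {S = J m} P good _ _ _ = descent-J good

  accepted-reduced⇔avoids : ∀ {σ} → Permutes n σ →
    (∃ λ w → ReducedOn n w σ × ¬ runD j w ≡ deadD) ⇔ (¬ Occurs n (PatternKIJ j) σ)
  accepted-reduced⇔avoids = Criterion.accepted-reduced⇔avoids n stepD (G j) deadD
    (λ σ → ¬ Occurs n (PatternKIJ j) σ) (avoids-cong n (PatternKIJ j)) Good
    (λ _ → refl) good-start good-ascent good⇒avoids good⇒alive avoids⇒good good-descent good-identity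

extend : ∀ {n} → (Fin n → Fin n) → ℕ → ℕ
extend f zero = zero
extend {n} f (suc y) with y <? n
... | yes y<n = suc (toℕ (f (fromℕ< y<n)))
... | no _ = suc y

extend-fin : ∀ {n} (f : Fin n → Fin n) i → extend f (suc (toℕ i)) ≡ suc (toℕ (f i))
extend-fin {n} f i with toℕ i <? n
... | yes i<n = cong (λ k → suc (toℕ (f k))) (fromℕ<-toℕ i i<n)
... | no i≮n = contradiction (toℕ<n i) i≮n

data ExtendView (n : ℕ) : ℕ → Set where
  zero-pt : ExtendView n zero
  inside  : ∀ (i : Fin n) → ExtendView n (suc (toℕ i))
  outside : ∀ y → ¬ y < n → ExtendView n (suc y)

extendView : ∀ n x → ExtendView n x
extendView n zero = zero-pt
extendView n (suc y) with y <? n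
... | yes y<n = subst (λ t → ExtendView n (suc t)) (toℕ-fromℕ< y<n) (inside (fromℕ< y<n))
... | no y≮n = outside y y≮n

extend-outside : ∀ {n} (f : Fin n → Fin n) y → ¬ y < n → extend f (suc y) ≡ suc y
extend-outside {n} f y y≮n with y <? n
... | yes y<n = contradiction y<n y≮n
... | no _ = refl

extend-inverse : ∀ {n} (f g : Fin n → Fin n) → (∀ i → f (g i) ≡ i) → ∀ x → extend f (extend g x) ≡ x
extend-inverse {n} f g f∘g x with extendView n x
... | zero-pt = refl
... | inside i = trans (cong (extend f) (extend-fin g i)) (trans (extend-fin f (g i)) (cong (λ k → suc (toℕ k)) (f∘g i)))
... | outside y y≮n = trans (cong (extend f) (extend-outside g y y≮n)) (extend-outside f y y≮n)

toFin : ∀ {n x} → 1 ≤ x → x ≤ n → Σ (Fin n) λ i → x ≡ suc (toℕ i)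
toFin {n} {x} 1≤x x≤n with extendView n x
... | inside i = i , refl
... | outside y y≮n = contradiction x≤n y≮n

extend-inRange : ∀ {n} (f : Fin n → Fin n) {x} → 1 ≤ x → x ≤ n → 1 ≤ extend f x × extend f x ≤ n
extend-inRange f 1≤x x≤n with toFin 1≤x x≤n
... | i , refl rewrite extend-fin f i = s≤s z≤n , toℕ<n (f i)

module _ {n} (π : Permutation′ n) where

  onℕ : ℕ → ℕ
  onℕ = extend (π ⟨$⟩ʳ_)

  permutes : Permutes n onℕ
  permutes = record
    { σ⁻¹ = extend (π ⟨$⟩ˡ_)
    ; inverseʳ = extend-inverse _ _ (λ _ → ⟨$⟩ʳ∘⟨$⟩ˡ π)
    ; inverseˡ = extend-inverse _ _ (λ _ → ⟨$⟩ˡ∘⟨$⟩ʳ π)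
    ; σ-inRange = extend-inRange _
    ; σ⁻¹-inRange = extend-inRange _
    }

  represents⇔ : ∀ w → Represents w π ⇔ RepresentsOn n w onℕ
  represents⇔ w = mk⇔
    (λ (valid , w≈π) → valid , λ x 1≤x x≤n → at x 1≤x x≤n w≈π)
    (λ (valid , w≈σ) → valid , λ i → trans (w≈σ (suc (toℕ i)) (s≤s z≤n) (toℕ<n i)) (extend-fin _ i))
    where
    at : ∀ x → 1 ≤ x → x ≤ n → (∀ i → evalWord w (suc (toℕ i)) ≡ val π i) → evalWord w x ≡ onℕ x
    at x 1≤x x≤n w≈π with toFin 1≤x x≤n
    ... | i , refl = trans (w≈π i) (sym (extend-fin _ i))

  reduced⇔ : ∀ w → Reduced w π ⇔ ReducedOn n w onℕ
  reduced⇔ w = mk⇔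
    (λ (rep , minimal) → Equivalence.to (represents⇔ w) rep , λ w′ rep′ → minimal w′ (Equivalence.from (represents⇔ w′) rep′))
    (λ (rep , minimal) → Equivalence.from (represents⇔ w) rep , λ w′ rep′ → minimal w′ (Equivalence.to (represents⇔ w′) rep′))

  OccursIn : (ℕ → ℕ → ℕ → Set) → Set
  OccursIn R = Σ (Fin n) λ p → Σ (Fin n) λ q → Σ (Fin n) λ r →
    toℕ p < toℕ q × toℕ q < toℕ r × R (val π p) (val π q) (val π r)

  occurs⇔ : ∀ R → Occurs n R onℕ ⇔ OccursIn R
  occurs⇔ R = mk⇔ to from
    where
    to : Occurs n R onℕ → OccursIn R
    to (x , y , z , 1≤x , x<y , y<z , z≤last , Rxyz)
      with toFin 1≤x (<⇒≤ (<-≤-trans x<y (<⇒≤ (<-≤-trans y<z z≤last))))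
         | toFin (≤-trans 1≤x (<⇒≤ x<y)) (<⇒≤ (<-≤-trans y<z z≤last))
         | toFin (≤-trans 1≤x (<⇒≤ (<-trans x<y y<z))) z≤last
    ... | p , refl | q , refl | r , refl =
      p , q , r , ≤-pred x<y , ≤-pred y<z ,
      subst₂ (R (val π p)) (extend-fin _ q) (extend-fin _ r) (subst (λ u → R u (onℕ y) (onℕ z)) (extend-fin _ p) Rxyz)
    from : OccursIn R → Occurs n R onℕ
    from (p , q , r , p<q , q<r , Rpqr) =
      suc (toℕ p) , suc (toℕ q) , suc (toℕ r) , s≤s z≤n , s≤s p<q , s≤s q<r , toℕ<n r ,
      subst₂ (R (onℕ (suc (toℕ p)))) (sym (extend-fin _ q)) (sym (extend-fin _ r))
        (subst (λ u → R u (val π q) (val π r)) (sym (extend-fin _ p)) Rpqr)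

  transfer : ∀ (Accepted : Word → Set) R →
    (∃ λ w → ReducedOn n w onℕ × Accepted w) ⇔ (¬ Occurs n R onℕ) →
    (∃ λ w → Reduced w π × Accepted w) ⇔ (¬ OccursIn R)
  transfer Accepted R equiv = mk⇔
    (λ (w , reduced , accepted) occurs →
      Equivalence.to equiv (w , Equivalence.to (reduced⇔ w) reduced , accepted) (Equivalence.from (occurs⇔ R) occurs))
    (λ avoids → let (w , reduced , accepted) = Equivalence.from equiv (λ occurs → avoids (Equivalence.to (occurs⇔ R) occurs)) in
                w , Equivalence.from (reduced⇔ w) reduced , accepted)

theorem4p16 : ∀ (n : ℕ) → 3 ≤ n → ∀ (j : ℕ) → 2 ≤ j → j < n → (π : Permutation′ n) →
    ((∃ λ w → Reduced w π × AcceptsU n j w) ⇔ AvoidsJKI π j)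
      × ((∃ λ w → Reduced w π × AcceptsD j w) ⇔ AvoidsKIJ π j)
theorem4p16 n _ j 2≤j j<n π =
  transfer π (AcceptsU n j) (PatternJKI j) (AutomatonU.accepted-reduced⇔avoids n j 1≤j j<n (permutes π)) ,
  transfer π (AcceptsD j) (PatternKIJ j) (AutomatonD.accepted-reduced⇔avoids n j 2≤j j<n (permutes π))
  where
  1≤j : 1 ≤ j
  1≤j = ≤-trans (s≤s z≤n) 2≤j
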